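{- Let $p\equiv 3\pmod 4$ be a prime. For an integer $k$, let $R(k,p)$ be the unique $r\in\{0,1,\dots,\frac{p-1}{2}\}$ such that $k\equiv r\pmod p$ or $k\equiv -r\pmod p$. Define $$N_p=\#\left\{(i,j):\ 1\le i<j\le \tfrac{p-1}{2}\ \text{and}\ R(i^2,p)>R(j^2,p)\right\}.$$ Then $N_p\equiv\left\lfloor\frac{p+1}{8}\right\rfloor\pmod 2$.
   Context: $\#S$ denotes the cardinality of a finite set $S$ and $\lfloor\cdot\rfloor$ the floor function. -}

module Defs where

open import Data.Nat using (ℕ; zero; suc; _+_; _*_; _∸_; _≤ᵇ_; _<ᵇ_; NonZero)
open import Data.Nat.DivMod using (_%_; _/_)
open import Data.Bool using (if_then_else_)
open import Data.List using (List; []; _∷_; length; filter; concatMap; map)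
open import Data.List.Base using (upTo)
open import Data.Product using (_×_; _,_)
open import Relation.Nullary.Decidable using (does)
open import Data.Nat using (_<?_)

R : ℕ → (p : ℕ) → .{{NonZero p}} → ℕ
R k p = let s = k % p in
  if s ≤ᵇ ((p ∸ 1) / 2) then s else p ∸ s

pairs : ℕ → List (ℕ × ℕ)
pairs m = concatMap (λ j → map (λ i → (suc i , suc j)) (upTo j)) (upTo m)

N : (p : ℕ) → .{{NonZero p}} → ℕ
N p = length (filter (λ ij → let (i , j) = ij in R (j * j) p <? R (i * i) p)
                     (pairs ((p ∸ 1) / 2)))

-- Write p = 4k + 3 and m = (p − 1)/2. Since −1 is a nonresidue, σ i = R(i², p) permutes 1, …, m
-- (its inverse is r ↦ R(r^(k+1), p)), and N_p counts the inversions of σ. For i < j,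
--   [σ j < σ i] = β(i, j) ⊕ β(σ i, σ j) ⊕ [i² + j² is a nonresidue],
-- where β(x, y) = [x < y] ⊕ [y² − x² is a residue] is symmetric; summed over all pairs the two β-sums
-- coincide because σ is a permutation, so N_p ≡ T (mod 2) with T = #{i < j : i² + j² nonresidue}.
-- Counting T row by row, 2T + m·[2 is a nonresidue] = m·#{l : 1 + l² nonresidue}, and the last count
-- is k + 1 because ∑ χ(1 + l²) = −1, which reduces to the Jacobi sum ∑ χ(w) χ(1 + w) = −1.
-- With Gauss' lemma for (2/p) this gives T = m·⌊(p + 1)/8⌋, and m is odd.

module Submission where

open import Algebra.Bundles using (CommutativeMonoid)
open import Algebra.Structures using (IsCommutativeMonoid)
open import Data.Bool using (Bool; true; false; if_then_else_; T; not; _xor_)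
open import Data.Bool.Properties using (not-involutive)
open import Data.Empty using (⊥-elim)
open import Data.Fin using (Fin; toℕ; fromℕ<)
open import Data.Fin.Permutation using (Permutation; permutation)
open import Data.Fin.Properties using (toℕ-fromℕ<; toℕ-injective; toℕ<n)
open import Data.Integer using (ℤ; 0ℤ; 1ℤ; -1ℤ) renaming (_+_ to _+ℤ_; _*_ to _*ℤ_)
import Data.Integer as ℤ
import Data.Integer.Properties as ℤₚ
import Data.Integer.Tactic.RingSolver as ℤ-Solver
open import Data.List using (List; _++_; length; filter; concatMap; map; upTo; applyUpTo)
open import Data.List.Properties using (length-++; filter-++; map-upTo)
open import Data.Nat
open import Data.Nat.Coprimality using (Coprime; coprime-Bézout)
open import Data.Nat.DivMod
open import Data.Nat.Divisibility using (divides-refl; m%n≡0⇒n∣m; n∣m⇒m%n≡0)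
open import Data.Nat.GCD using (module Bézout)
open import Data.Nat.Primality using (Prime; euclidsLemma; prime⇒irreducible; prime⇒nonTrivial)
open import Data.Nat.Properties
open import Algebra.Properties.CommutativeSemigroup *-commutativeSemigroup using ()
  renaming (x∙yz≈y∙xz to *-left-comm)
open import Data.Nat.Tactic.RingSolver using (solve-∀)
open import Data.Product using (_×_; _,_; proj₁; proj₂; ∃)
open import Data.Sum using (_⊎_; inj₁; inj₂)
open import Function using (_∘_; id)
open import Level using (0ℓ)
open import Relation.Binary.PropositionalEquality
open import Relation.Nullary using (¬_; Dec; yes; no; does)
open import Relation.Nullary.Decidable using (dec-true; dec-false)
open import Relation.Unary using (Pred; Decidable)

open import Defs

𝟙 : Bool → ℕ
𝟙 true  = 1
𝟙 false = 0

𝟙-xor₃ : ∀ a b c → 𝟙 (a xor b xor c) + (𝟙 a + 𝟙 b + 𝟙 c) ≡ ⌈ 𝟙 a + 𝟙 b + 𝟙 c /2⌉ + ⌈ 𝟙 a + 𝟙 b + 𝟙 c /2⌉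
𝟙-xor₃ true  true  true  = refl
𝟙-xor₃ true  true  false = refl
𝟙-xor₃ true  false true  = refl
𝟙-xor₃ true  false false = refl
𝟙-xor₃ false true  true  = refl
𝟙-xor₃ false true  false = refl
𝟙-xor₃ false false true  = refl
𝟙-xor₃ false false false = refl

%2-≡-of-even-sum : ∀ a b c d → a + (c + c + b) ≡ d + d → a % 2 ≡ b % 2
%2-≡-of-even-sum a b c d eq = bits (a % 2) (b % 2) (m%n<n a 2) (m%n<n b 2) (trans (sym (%-distribˡ-+ a b 2)) [a+b]%2≡0)
  where
    rearrange : ∀ a b c → a + (c + c + b) ≡ a + b + c * 2
    rearrange = solve-∀
    [a+b]%2≡0 : (a + b) % 2 ≡ 0
    [a+b]%2≡0 = begin
      (a + b) % 2         ≡⟨ [m+kn]%n≡m%n (a + b) c 2 ⟨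
      (a + b + c * 2) % 2 ≡⟨ cong (_% 2) (trans (sym (rearrange a b c)) eq) ⟩
      (d + d) % 2         ≡⟨ cong (_% 2) (trans (cong (d +_) (sym (+-identityʳ d))) (*-comm 2 d)) ⟩
      (d * 2) % 2         ≡⟨ m*n%n≡0 d 2 ⟩
      0                   ∎
      where open ≡-Reasoning
    bits : ∀ x y → x < 2 → y < 2 → (x + y) % 2 ≡ 0 → x ≡ y
    bits 0 0 _ _ _ = refl
    bits 1 1 _ _ _ = refl
    bits 0 1 _ _ ()
    bits 1 0 _ _ ()
    bits (suc (suc _)) _ (s≤s (s≤s ())) _ _
    bits _ (suc (suc _)) _ (s≤s (s≤s ())) _

m+m≡n+n⇒m≡n : ∀ {m n} → m + m ≡ n + n → m ≡ n
m+m≡n+n⇒m≡n {m} {n} eq = *-cancelˡ-≡ m n 2 (trans (double m) (trans eq (sym (double n))))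
  where double : ∀ x → 2 * x ≡ x + x
        double x = cong (x +_) (+-identityʳ x)

even-or-odd : ∀ n → ∃ (λ j → n ≡ j + j) ⊎ ∃ (λ j → n ≡ suc (j + j))
even-or-odd zero = inj₁ (0 , refl)
even-or-odd (suc n) with even-or-odd n
... | inj₁ (j , n≡j+j)   = inj₂ (j , cong suc n≡j+j)
... | inj₂ (j , n≡1+j+j) = inj₁ (suc j , trans (cong suc n≡1+j+j) (sym (cong suc (+-suc j j))))

odd*-%2 : ∀ k x → (suc (2 * k) * x) % 2 ≡ x % 2
odd*-%2 k x = begin
  (suc (2 * k) * x) % 2 ≡⟨ cong (_% 2) (expand k x) ⟩
  (x + (k * x) * 2) % 2 ≡⟨ [m+kn]%n≡m%n x (k * x) 2 ⟩
  x % 2                 ∎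
  where open ≡-Reasoning
        expand : ∀ k x → suc (2 * k) * x ≡ x + (k * x) * 2
        expand = solve-∀

^-distribʳ-* : ∀ a b n → (a * b) ^ n ≡ a ^ n * b ^ n
^-distribʳ-* a b zero    = refl
^-distribʳ-* a b (suc n) = trans (cong (a * b *_) (^-distribʳ-* a b n)) (interchange a b (a ^ n) (b ^ n))
  where interchange : ∀ a b c d → a * b * (c * d) ≡ a * c * (b * d)
        interchange = solve-∀

±1 : Bool → ℤ
±1 true  = 1ℤ
±1 false = -1ℤ

±1-not-xor : ∀ u v → ±1 (not (u xor v)) ≡ ±1 u *ℤ ±1 v
±1-not-xor true  true  = refl
±1-not-xor true  false = refl
±1-not-xor false true  = refl
±1-not-xor false false = refl

lt : ℕ → ℕ → Bool
lt a b = does (a <? b)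

lt-flip : ∀ {a b} → a ≢ b → lt a b ≡ not (lt b a)
lt-flip {a} {b} a≢b = flip (a <? b) (b <? a)
  where
    flip : Dec (a < b) → Dec (b < a) → does (a <? b) ≡ not (does (b <? a))
    flip (yes a<b) (yes b<a) = ⊥-elim (<-asym a<b b<a)
    flip (yes a<b) (no b≮a)  = trans (dec-true (a <? b) a<b) (cong not (sym (dec-false (b <? a) b≮a)))
    flip (no a≮b)  (yes b<a) = trans (dec-false (a <? b) a≮b) (cong not (sym (dec-true (b <? a) b<a)))
    flip (no a≮b)  (no b≮a)  = ⊥-elim (a≢b (≤-antisym (≮⇒≥ b≮a) (≮⇒≥ a≮b)))

record InverseOn (n : ℕ) (f g : ℕ → ℕ) : Set where
  field
    f-range : ∀ i → 1 ≤ i → i ≤ n → 1 ≤ f i × f i ≤ n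
    g-range : ∀ i → 1 ≤ i → i ≤ n → 1 ≤ g i × g i ≤ n
    f∘g     : ∀ i → 1 ≤ i → i ≤ n → f (g i) ≡ i
    g∘f     : ∀ i → 1 ≤ i → i ≤ n → g (f i) ≡ i

  sym-inverse : InverseOn n g f
  sym-inverse = record { f-range = g-range ; g-range = f-range ; f∘g = g∘f ; g∘f = f∘g }

module ∑-Properties {A : Set} (_∙_ : A → A → A) (ε : A)
                    (isCommutativeMonoid : IsCommutativeMonoid _≡_ _∙_ ε) where

  open IsCommutativeMonoid isCommutativeMonoid using (assoc; identityˡ; identityʳ)
  private
    monoid : CommutativeMonoid 0ℓ 0ℓ
    monoid = record { isCommutativeMonoid = isCommutativeMonoid }
  open import Algebra.Properties.CommutativeMonoid.Sum monoid using (sum; sum-cong-≗; sum-permute; ∑-distrib-+)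

  ∑ : ℕ → (ℕ → A) → A
  ∑ n f = sum {n} (f ∘ suc ∘ toℕ)

  ∑-cong : ∀ n {f g : ℕ → A} → (∀ i → 1 ≤ i → i ≤ n → f i ≡ g i) → ∑ n f ≡ ∑ n g
  ∑-cong zero    eq = refl
  ∑-cong (suc n) eq = cong₂ _∙_ (eq 1 ≤-refl (s≤s z≤n))
                                (∑-cong n (λ i 1≤i i≤n → eq (suc i) (s≤s z≤n) (s≤s i≤n)))

  ∑-snoc : ∀ n f → ∑ (suc n) f ≡ ∑ n f ∙ f (suc n)
  ∑-snoc zero    f = trans (identityʳ (f 1)) (sym (identityˡ (f 1)))
  ∑-snoc (suc n) f = trans (cong (f 1 ∙_) (∑-snoc n (f ∘ suc))) (sym (assoc (f 1) _ _))

  ∑-ε : ∀ n → ∑ n (λ _ → ε) ≡ ε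
  ∑-ε zero    = refl
  ∑-ε (suc n) = trans (cong (ε ∙_) (∑-ε n)) (identityˡ ε)

  ∑-distrib : ∀ n f g → ∑ n (λ i → f i ∙ g i) ≡ ∑ n f ∙ ∑ n g
  ∑-distrib n f g = ∑-distrib-+ {n} (f ∘ suc ∘ toℕ) (g ∘ suc ∘ toℕ)

  ∑-+ : ∀ a b f → ∑ (a + b) f ≡ ∑ a f ∙ ∑ b (λ i → f (a + i))
  ∑-+ zero    b f = sym (identityˡ _)
  ∑-+ (suc a) b f = trans (cong (f 1 ∙_) (∑-+ a b (f ∘ suc))) (sym (assoc (f 1) _ _))

  ∑-reindex : ∀ n {f g} → InverseOn n f g → ∀ h → ∑ n (h ∘ f) ≡ ∑ n h
  ∑-reindex n {f} {g} inv h =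
    trans (sum-cong-≗ (cong h ∘ sym ∘ restrict-toℕ f-range)) (sym (sum-permute (h ∘ suc ∘ toℕ) π))
    where
      open InverseOn inv
      Range : (ℕ → ℕ) → Set
      Range u = ∀ i → 1 ≤ i → i ≤ n → 1 ≤ u i × u i ≤ n
      pred<n : ∀ {y} → 1 ≤ y × y ≤ n → pred y < n
      pred<n (s≤s _ , y≤n) = y≤n
      suc∘pred : ∀ {y} → 1 ≤ y × y ≤ n → suc (pred y) ≡ y
      suc∘pred (s≤s _ , _) = refl
      restrict : ∀ {u} → Range u → Fin n → Fin n
      restrict range i = fromℕ< (pred<n (range (suc (toℕ i)) (s≤s z≤n) (toℕ<n i)))
      restrict-toℕ : ∀ {u} (range : Range u) i → suc (toℕ (restrict range i)) ≡ u (suc (toℕ i))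
      restrict-toℕ range i = trans (cong suc (toℕ-fromℕ< _)) (suc∘pred (range (suc (toℕ i)) (s≤s z≤n) (toℕ<n i)))
      restrict-inverse : ∀ {u v} (ru : Range u) (rv : Range v) →
                         (∀ i → 1 ≤ i → i ≤ n → u (v i) ≡ i) → ∀ i → restrict ru (restrict rv i) ≡ i
      restrict-inverse {u} {v} ru rv u∘v i = toℕ-injective (suc-injective (begin
        suc (toℕ (restrict ru (restrict rv i))) ≡⟨ restrict-toℕ ru (restrict rv i) ⟩
        u (suc (toℕ (restrict rv i)))           ≡⟨ cong u (restrict-toℕ rv i) ⟩
        u (v (suc (toℕ i)))                     ≡⟨ u∘v (suc (toℕ i)) (s≤s z≤n) (toℕ<n i) ⟩
        suc (toℕ i)                             ∎))
        where open ≡-Reasoning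
      π : Permutation n n
      π = permutation (restrict f-range) (restrict g-range)
                      (restrict-inverse f-range g-range f∘g) (restrict-inverse g-range f-range g∘f)

open ∑-Properties _+_ 0 +-0-isCommutativeMonoid
open ∑-Properties _*_ 1 *-1-isCommutativeMonoid using ()
  renaming (∑ to ∏; ∑-cong to ∏-cong; ∑-distrib to ∏-distrib; ∑-+ to ∏-+; ∑-reindex to ∏-reindex)

open ∑-Properties _+ℤ_ 0ℤ ℤₚ.+-0-isCommutativeMonoid using ()
  renaming (∑ to ∑ℤ; ∑-cong to ∑ℤ-cong; ∑-snoc to ∑ℤ-snoc; ∑-ε to ∑ℤ-ε; ∑-distrib to ∑ℤ-distrib;
            ∑-+ to ∑ℤ-+; ∑-reindex to ∑ℤ-reindex)

∑ℤ-cast : ∀ n f → ∑ℤ n (λ i → ℤ.+ f i) ≡ ℤ.+ ∑ n f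
∑ℤ-cast zero    f = refl
∑ℤ-cast (suc n) f = cong (ℤ.+ f 1 +ℤ_) (∑ℤ-cast n (f ∘ suc))

∏-const : ∀ n x → ∏ n (λ _ → x) ≡ x ^ n
∏-const zero    x = refl
∏-const (suc n) x = cong (x *_) (∏-const n x)

∑-const : ∀ n c → ∑ n (λ _ → c) ≡ n * c
∑-const zero    c = refl
∑-const (suc n) c = cong (c +_) (∑-const n c)

∑pairs : ℕ → (ℕ → ℕ → ℕ) → ℕ
∑pairs n c = ∑ n (λ j → ∑ (pred j) (λ i → c i j))

∑square : ℕ → (ℕ → ℕ → ℕ) → ℕ
∑square n c = ∑ n (λ i → ∑ n (c i))

∑diagonal : ℕ → (ℕ → ℕ → ℕ) → ℕ
∑diagonal n c = ∑ n (λ i → c i i)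

SymmetricOn : ℕ → (ℕ → ℕ → ℕ) → Set
SymmetricOn n c = ∀ i j → 1 ≤ i → i ≤ n → 1 ≤ j → j ≤ n → c i j ≡ c j i

∑pairs-distrib : ∀ n c d → ∑pairs n (λ i j → c i j + d i j) ≡ ∑pairs n c + ∑pairs n d
∑pairs-distrib n c d =
  trans (∑-cong n (λ j _ _ → ∑-distrib (pred j) (λ i → c i j) (λ i → d i j)))
        (∑-distrib n (λ j → ∑ (pred j) (λ i → c i j)) (λ j → ∑ (pred j) (λ i → d i j)))

∑pairs-cong : ∀ n {c d} → (∀ i j → 1 ≤ i → i < j → j ≤ n → c i j ≡ d i j) → ∑pairs n c ≡ ∑pairs n d
∑pairs-cong n {c} {d} eq = ∑-cong n {λ j → ∑ (pred j) (λ i → c i j)} {λ j → ∑ (pred j) (λ i → d i j)}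
  (λ { (suc j) 1≤j j≤n → ∑-cong j (λ i 1≤i i≤j → eq i (suc j) 1≤i (s≤s i≤j) j≤n) })

∑square-reindex : ∀ n {f g} → InverseOn n f g → ∀ c → ∑square n (λ i j → c (f i) (f j)) ≡ ∑square n c
∑square-reindex n {f} inv c =
  trans (∑-cong n (λ i _ _ → ∑-reindex n inv (c (f i)))) (∑-reindex n inv (λ i → ∑ n (c i)))

∑diagonal-reindex : ∀ n {f g} → InverseOn n f g → ∀ c → ∑diagonal n (λ i j → c (f i) (f j)) ≡ ∑diagonal n c
∑diagonal-reindex n inv c = ∑-reindex n inv (λ i → c i i)

∑square-symmetric : ∀ n c → SymmetricOn n c → ∑pairs n c + ∑pairs n c + ∑diagonal n c ≡ ∑square n c
∑square-symmetric zero    c sym-c = refl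
∑square-symmetric (suc n) c sym-c = begin
  P′ + P′ + D′                               ≡⟨ cong₂ (λ a b → a + a + b) (∑-snoc n (λ j → ∑ (pred j) (λ i → c i j)))
                                                                       (∑-snoc n (λ i → c i i)) ⟩
  (P + column) + (P + column) + (D + corner) ≡⟨ regroup P column D corner ⟩
  (P + P + D) + column + (column + corner)   ≡⟨ cong (λ z → z + column + (column + corner))
                                                     (∑square-symmetric n c (λ i j 1≤i i≤n 1≤j j≤n →
                                                        sym-c i j 1≤i (m≤n⇒m≤1+n i≤n) 1≤j (m≤n⇒m≤1+n j≤n))) ⟩
  ∑square n c + column + (column + corner)   ≡⟨ cong (λ z → ∑square n c + z + (column + corner)) column≡row ⟩
  ∑square n c + row + (column + corner)      ≡⟨ cong₂ _+_ (sym (∑-snoc n (λ i → ∑ n (c i))))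
                                                          (sym (∑-snoc n (λ i → c i (suc n)))) ⟩
  ∑ (suc n) (λ i → ∑ n (c i)) + ∑ (suc n) (λ i → c i (suc n))
                                             ≡⟨ sym (∑-distrib (suc n) (λ i → ∑ n (c i)) (λ i → c i (suc n))) ⟩
  ∑ (suc n) (λ i → ∑ n (c i) + c i (suc n))  ≡⟨ ∑-cong (suc n) (λ i _ _ → sym (∑-snoc n (c i))) ⟩
  ∑square (suc n) c                          ∎
  where
    open ≡-Reasoning
    P′ D′ P D column row corner : ℕ
    P′ = ∑pairs (suc n) c
    D′ = ∑diagonal (suc n) c
    P = ∑pairs n c
    D = ∑diagonal n c
    column = ∑ n (λ i → c i (suc n))
    row = ∑ n (c (suc n))
    corner = c (suc n) (suc n)
    regroup : ∀ a x b d → (a + x) + (a + x) + (b + d) ≡ (a + a + b) + x + (x + d)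
    regroup = solve-∀
    column≡row : column ≡ row
    column≡row = ∑-cong n (λ i 1≤i i≤n → sym-c i (suc n) 1≤i (m≤n⇒m≤1+n i≤n) (s≤s z≤n) ≤-refl)

module _ {P : Pred (ℕ × ℕ) 0ℓ} (P? : Decidable P) where

  private
    count : ℕ × ℕ → ℕ
    count = 𝟙 ∘ does ∘ P?

    length-filter-applyUpTo : ∀ f n → length (filter P? (applyUpTo f n)) ≡ ∑ n (count ∘ f ∘ pred)
    length-filter-applyUpTo f zero = refl
    length-filter-applyUpTo f (suc n) with does (P? (f 0))
    ... | true  = cong suc (length-filter-applyUpTo (f ∘ suc) n)
    ... | false = length-filter-applyUpTo (f ∘ suc) n

    length-filter-concatMap : ∀ F (f : ℕ → ℕ) n →
      length (filter P? (concatMap F (applyUpTo f n))) ≡ ∑ n (λ j → length (filter P? (F (f (pred j)))))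
    length-filter-concatMap F f zero    = refl
    length-filter-concatMap F f (suc n) = begin
      length (filter P? (F (f 0) ++ rest))                  ≡⟨ cong length (filter-++ P? (F (f 0)) rest) ⟩
      length (filter P? (F (f 0)) ++ filter P? rest)        ≡⟨ length-++ (filter P? (F (f 0))) ⟩
      length (filter P? (F (f 0))) + length (filter P? rest)
        ≡⟨ cong (length (filter P? (F (f 0))) +_) (length-filter-concatMap F (f ∘ suc) n) ⟩
      ∑ (suc n) (λ j → length (filter P? (F (f (pred j))))) ∎
      where open ≡-Reasoning
            rest : List (ℕ × ℕ)
            rest = concatMap F (applyUpTo (f ∘ suc) n)

  length-filter-pairs : ∀ n → length (filter P? (pairs n)) ≡ ∑pairs n (λ i j → count (i , j))
  length-filter-pairs n =
    trans (length-filter-concatMap row id n)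
          (∑-cong n {λ j → length (filter P? (row (pred j)))} {λ j → ∑ (pred j) (λ i → count (i , j))}
                  (λ { (suc j) _ _ → row-count j }))
    where
      row : ℕ → List (ℕ × ℕ)
      row j = map (λ i → suc i , suc j) (upTo j)
      row-count : ∀ j → length (filter P? (row j)) ≡ ∑ j (λ i → count (i , suc j))
      row-count j = trans (cong (length ∘ filter P?) (map-upTo (λ i → suc i , suc j) j))
                          (trans (length-filter-applyUpTo (λ i → suc i , suc j) j)
                                 (∑-cong j {λ i → count (suc (pred i) , suc j)} {λ i → count (i , suc j)}
                                         (λ { (suc i) _ _ → refl })))

∑pairs-reindex : ∀ n {f g} → InverseOn n f g → ∀ c → SymmetricOn n c →
                 ∑pairs n (λ i j → c (f i) (f j)) ≡ ∑pairs n c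
∑pairs-reindex n {f} inv c sym-c = m+m≡n+n⇒m≡n (+-cancelʳ-≡ (∑diagonal n c) _ _ (begin
  ∑pairs n c∘f + ∑pairs n c∘f + ∑diagonal n c   ≡⟨ cong (∑pairs n c∘f + ∑pairs n c∘f +_) (∑diagonal-reindex n inv c) ⟨
  ∑pairs n c∘f + ∑pairs n c∘f + ∑diagonal n c∘f ≡⟨ ∑square-symmetric n c∘f sym-c∘f ⟩
  ∑square n c∘f                                 ≡⟨ ∑square-reindex n inv c ⟩
  ∑square n c                                   ≡⟨ ∑square-symmetric n c sym-c ⟨
  ∑pairs n c + ∑pairs n c + ∑diagonal n c       ∎))
  where
    open ≡-Reasoning
    open InverseOn inv
    c∘f : ℕ → ℕ → ℕ
    c∘f i j = c (f i) (f j)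
    sym-c∘f : SymmetricOn n c∘f
    sym-c∘f i j 1≤i i≤n 1≤j j≤n =
      sym-c (f i) (f j) (proj₁ (f-range i 1≤i i≤n)) (proj₂ (f-range i 1≤i i≤n))
                        (proj₁ (f-range j 1≤j j≤n)) (proj₂ (f-range j 1≤j j≤n))

module OddPrime {p : ℕ} (m : ℕ) (p≡ : p ≡ suc (m + m)) (prime : Prime p) where

  instance
    p-nonZero : NonZero p
    p-nonZero = ≢-nonZero (λ p≡0 → 1+n≢0 (trans (sym p≡) p≡0))

  1<p : 1 < p
  1<p = nonTrivial⇒n>1 p {{prime⇒nonTrivial prime}}

  0<p : 0 < p
  0<p = <-trans z<s 1<p

  m<p : m < p
  m<p = subst (m <_) (sym p≡) (s≤s (m≤m+n m m))

  -1ₚ : ℕ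
  -1ₚ = p ∸ 1

  p≡1+[-1ₚ] : p ≡ suc -1ₚ
  p≡1+[-1ₚ] = sym (suc-pred p)

  -1ₚ<p : -1ₚ < p
  -1ₚ<p = subst (-1ₚ <_) (sym p≡1+[-1ₚ]) ≤-refl

  infix 4 _≋_
  _≋_ : ℕ → ℕ → Set
  a ≋ b = a % p ≡ b % p

  ≡⇒≋ : ∀ {a b} → a ≡ b → a ≋ b
  ≡⇒≋ = cong (_% p)

  ≋-+ : ∀ {a b c d} → a ≋ b → c ≋ d → a + c ≋ b + d
  ≋-+ {a} {b} {c} {d} a≋b c≋d =
    trans (%-distribˡ-+ a c p) (trans (cong₂ (λ x y → (x + y) % p) a≋b c≋d) (sym (%-distribˡ-+ b d p)))

  ≋-* : ∀ {a b c d} → a ≋ b → c ≋ d → a * c ≋ b * d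
  ≋-* {a} {b} {c} {d} a≋b c≋d =
    trans (%-distribˡ-* a c p) (trans (cong₂ (λ x y → (x * y) % p) a≋b c≋d) (sym (%-distribˡ-* b d p)))

  ≋-+ˡ : ∀ c {a b} → a ≋ b → c + a ≋ c + b
  ≋-+ˡ c = ≋-+ {c} refl

  ≋-*ˡ : ∀ c {a b} → a ≋ b → c * a ≋ c * b
  ≋-*ˡ c = ≋-* {c} refl

  ≋-*ʳ : ∀ c {a b} → a ≋ b → a * c ≋ b * c
  ≋-*ʳ c a≋b = ≋-* a≋b (refl {x = c % p})

  ≋-^ : ∀ {a b} n → a ≋ b → a ^ n ≋ b ^ n
  ≋-^ zero    a≋b = refl
  ≋-^ (suc n) a≋b = ≋-* a≋b (≋-^ n a≋b)

  %≋ : ∀ a → a % p ≋ a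
  %≋ a = m%n%n≡m%n a p

  +*p≋ : ∀ a c → a + c * p ≋ a
  +*p≋ a c = [m+kn]%n≡m%n a c p

  0%p≡0 : 0 % p ≡ 0
  0%p≡0 = m<n⇒m%n≡m 0<p

  p≋0 : p ≋ 0
  p≋0 = trans (n%n≡0 p) (sym 0%p≡0)

  ≋-<⇒≡ : ∀ {a b} → a < p → b < p → a ≋ b → a ≡ b
  ≋-<⇒≡ a<p b<p a≋b = trans (sym (m<n⇒m%n≡m a<p)) (trans a≋b (m<n⇒m%n≡m b<p))

  +≋0⇒≋-1ₚ* : ∀ {u v} → u + v ≋ 0 → u ≋ -1ₚ * v
  +≋0⇒≋-1ₚ* {u} {v} u+v≋0 = begin
    u % p                   ≡⟨ sym (+*p≋ u v) ⟩
    (u + v * p) % p         ≡⟨ cong (λ z → (u + v * z) % p) p≡1+[-1ₚ] ⟩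
    (u + v * suc -1ₚ) % p   ≡⟨ cong (_% p) (regroup u v -1ₚ) ⟩
    ((u + v) + -1ₚ * v) % p ≡⟨ ≋-+ u+v≋0 (refl {x = (-1ₚ * v) % p}) ⟩
    (0 + -1ₚ * v) % p       ∎
    where open ≡-Reasoning
          regroup : ∀ u v q → u + v * suc q ≡ (u + v) + q * v
          regroup = solve-∀

  ∸≋-1ₚ* : ∀ {s} → s ≤ p → p ∸ s ≋ -1ₚ * s
  ∸≋-1ₚ* s≤p = +≋0⇒≋-1ₚ* (trans (cong (_% p) (m∸n+n≡m s≤p)) p≋0)

  -1ₚ²≋1 : -1ₚ * -1ₚ ≋ 1
  -1ₚ²≋1 = begin
    (q * q) % p             ≡⟨ sym (+*p≋ (q * q) 1) ⟩
    (q * q + 1 * p) % p     ≡⟨ cong (λ z → (q * q + 1 * z) % p) p≡1+[-1ₚ] ⟩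
    (q * q + 1 * suc q) % p ≡⟨ cong (_% p) (regroup q) ⟩
    (1 + q * suc q) % p     ≡⟨ cong (λ z → (1 + q * z) % p) (sym p≡1+[-1ₚ]) ⟩
    (1 + q * p) % p         ≡⟨ +*p≋ 1 q ⟩
    1 % p                   ∎
    where open ≡-Reasoning
          q : ℕ
          q = -1ₚ
          regroup : ∀ q → q * q + 1 * suc q ≡ 1 + q * suc q
          regroup = solve-∀

  -1ₚ*-1ₚ*≋ : ∀ x → -1ₚ * (-1ₚ * x) ≋ x
  -1ₚ*-1ₚ*≋ x = trans (≡⇒≋ (sym (*-assoc -1ₚ -1ₚ x))) (trans (≋-*ʳ x -1ₚ²≋1) (≡⇒≋ (*-identityˡ x)))

  infix 4 _≉0
  _≉0 : ℕ → Set
  x ≉0 = ¬ x ≋ 0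

  ≉0-≋ : ∀ {a b} → a ≋ b → a ≉0 → b ≉0
  ≉0-≋ a≋b a≉0 b≡0 = a≉0 (trans a≋b b≡0)

  ≉0-< : ∀ {a} → 1 ≤ a → a < p → a ≉0
  ≉0-< {suc a} _ a<p a≋0 = 1+n≢0 (≋-<⇒≡ a<p 0<p a≋0)

  ≉0-* : ∀ {x y} → x ≉0 → y ≉0 → x * y ≉0
  ≉0-* {x} {y} x≉0 y≉0 xy≋0 with euclidsLemma x y prime (m%n≡0⇒n∣m (x * y) p (trans xy≋0 0%p≡0))
  ... | inj₁ p∣x = x≉0 (trans (n∣m⇒m%n≡0 x p p∣x) (sym 0%p≡0))
  ... | inj₂ p∣y = y≉0 (trans (n∣m⇒m%n≡0 y p p∣y) (sym 0%p≡0))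

  ≉0-*⁻ʳ : ∀ {a b} → a * b ≉0 → b ≉0
  ≉0-*⁻ʳ {a} {b} ab≉0 b≋0 = ab≉0 (trans (≋-*ˡ a b≋0) (cong (_% p) (*-zeroʳ a)))

  ≉0-^ : ∀ {x} n → x ≉0 → x ^ n ≉0
  ≉0-^ zero    x≉0 = ≉0-< ≤-refl 1<p
  ≉0-^ (suc n) x≉0 = ≉0-* x≉0 (≉0-^ n x≉0)

  inverse : ∀ {x} → x ≉0 → ∃ λ y → x * y ≋ 1
  inverse {x} x≉0 with coprime-Bézout x⊥p
    where
      x⊥p : Coprime x p
      x⊥p (d∣x , d∣p) with prime⇒irreducible prime d∣p
      ... | inj₁ d≡1 = d≡1
      ... | inj₂ refl = ⊥-elim (x≉0 (trans (n∣m⇒m%n≡0 x p d∣x) (sym 0%p≡0)))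
  ... | Bézout.+- a b eq = a , (begin
    (x * a) % p     ≡⟨ cong (_% p) (trans (*-comm x a) (sym eq)) ⟩
    (1 + b * p) % p ≡⟨ +*p≋ 1 b ⟩
    1 % p           ∎)
    where open ≡-Reasoning
  ... | Bézout.-+ a b eq = a * -1ₚ , (begin
    (x * (a * -1ₚ)) % p ≡⟨ cong (_% p) (reassoc x a -1ₚ) ⟩
    ((a * x) * -1ₚ) % p ≡⟨ ≋-*ʳ -1ₚ ax≋-1ₚ ⟩
    (-1ₚ * 1 * -1ₚ) % p ≡⟨ cong (λ z → (z * -1ₚ) % p) (*-identityʳ -1ₚ) ⟩
    (-1ₚ * -1ₚ) % p     ≡⟨ -1ₚ²≋1 ⟩
    1 % p               ∎)
    where
      open ≡-Reasoning
      reassoc : ∀ x a q → x * (a * q) ≡ (a * x) * q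
      reassoc = solve-∀
      ax≋-1ₚ : a * x ≋ -1ₚ * 1
      ax≋-1ₚ = +≋0⇒≋-1ₚ* (trans (cong (_% p) (trans (+-comm (a * x) 1) eq))
                                 (trans (m*n%n≡0 b p) (sym 0%p≡0)))

  inverse-≉0 : ∀ x {y} → x * y ≋ 1 → y ≉0
  inverse-≉0 x xy≋1 = ≉0-*⁻ʳ {x} (≉0-≋ (sym xy≋1) (≉0-< ≤-refl 1<p))

  *-cancelʳ-≋ : ∀ {a b c} → c ≉0 → a * c ≋ b * c → a ≋ b
  *-cancelʳ-≋ {a} {b} {c} c≉0 ac≋bc with inverse c≉0
  ... | c′ , cc′≋1 = begin
    a % p              ≡⟨ cong (_% p) (sym (*-identityʳ a)) ⟩
    (a * 1) % p        ≡⟨ ≋-*ˡ a (sym cc′≋1) ⟩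
    (a * (c * c′)) % p ≡⟨ cong (_% p) (sym (*-assoc a c c′)) ⟩
    ((a * c) * c′) % p ≡⟨ ≋-*ʳ c′ ac≋bc ⟩
    ((b * c) * c′) % p ≡⟨ cong (_% p) (*-assoc b c c′) ⟩
    (b * (c * c′)) % p ≡⟨ ≋-*ˡ b cc′≋1 ⟩
    (b * 1) % p        ≡⟨ cong (_% p) (*-identityʳ b) ⟩
    b % p              ∎
    where open ≡-Reasoning

  infix 4 _±≋_
  _±≋_ : ℕ → ℕ → Set
  a ±≋ b = a ≋ b ⊎ a ≋ -1ₚ * b

  ±≋-sym : ∀ {a b} → a ±≋ b → b ±≋ a
  ±≋-sym (inj₁ a≋b)          = inj₁ (sym a≋b)
  ±≋-sym {b = b} (inj₂ a≋-b) = inj₂ (trans (sym (-1ₚ*-1ₚ*≋ b)) (≋-*ˡ -1ₚ (sym a≋-b)))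

  ±≋-trans : ∀ {a b c} → a ±≋ b → b ±≋ c → a ±≋ c
  ±≋-trans (inj₁ a≋b)  (inj₁ b≋c)  = inj₁ (trans a≋b b≋c)
  ±≋-trans (inj₁ a≋b)  (inj₂ b≋-c) = inj₂ (trans a≋b b≋-c)
  ±≋-trans (inj₂ a≋-b) (inj₁ b≋c)  = inj₂ (trans a≋-b (≋-*ˡ -1ₚ b≋c))
  ±≋-trans {c = c} (inj₂ a≋-b) (inj₂ b≋-c) = inj₁ (trans a≋-b (trans (≋-*ˡ -1ₚ b≋-c) (-1ₚ*-1ₚ*≋ c)))

  [-1ₚ*b]*[-1ₚ*d]≋b*d : ∀ b d → (-1ₚ * b) * (-1ₚ * d) ≋ b * d
  [-1ₚ*b]*[-1ₚ*d]≋b*d b d = begin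
    ((-1ₚ * b) * (-1ₚ * d)) % p ≡⟨ cong (_% p) (*-assoc -1ₚ b (-1ₚ * d)) ⟩
    (-1ₚ * (b * (-1ₚ * d))) % p ≡⟨ cong (λ z → (-1ₚ * z) % p) (*-left-comm b -1ₚ d) ⟩
    (-1ₚ * (-1ₚ * (b * d))) % p ≡⟨ -1ₚ*-1ₚ*≋ (b * d) ⟩
    (b * d) % p                 ∎
    where open ≡-Reasoning

  ±≋-* : ∀ {a b c d} → a ±≋ b → c ±≋ d → a * c ±≋ b * d
  ±≋-* (inj₁ a≋b) (inj₁ c≋d) = inj₁ (≋-* a≋b c≋d)
  ±≋-* {b = b} {d = d} (inj₁ a≋b) (inj₂ c≋-d) = inj₂ (trans (≋-* a≋b c≋-d) (≡⇒≋ (*-left-comm b -1ₚ d)))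
  ±≋-* {b = b} {d = d} (inj₂ a≋-b) (inj₁ c≋d) = inj₂ (trans (≋-* a≋-b c≋d) (≡⇒≋ (*-assoc -1ₚ b d)))
  ±≋-* {b = b} {d = d} (inj₂ a≋-b) (inj₂ c≋-d) = inj₁ (trans (≋-* a≋-b c≋-d) ([-1ₚ*b]*[-1ₚ*d]≋b*d b d))

  ±≋-^ : ∀ {a b} n → a ±≋ b → a ^ n ±≋ b ^ n
  ±≋-^ zero    a±≋b = inj₁ refl
  ±≋-^ (suc n) a±≋b = ±≋-* a±≋b (±≋-^ n a±≋b)

  ±≋⇒≋² : ∀ {a b} → a ±≋ b → a * a ≋ b * b
  ±≋⇒≋² (inj₁ a≋b)          = ≋-* a≋b a≋b
  ±≋⇒≋² {b = b} (inj₂ a≋-b) = trans (≋-* a≋-b a≋-b) ([-1ₚ*b]*[-1ₚ*d]≋b*d b b)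

  ±≋-≤⇒≡ : ∀ {a b} → a ≤ m → b ≤ m → a ±≋ b → a ≡ b
  ±≋-≤⇒≡ a≤m b≤m (inj₁ a≋b) = ≋-<⇒≡ (≤-<-trans a≤m m<p) (≤-<-trans b≤m m<p) a≋b
  ±≋-≤⇒≡ {a} {b} a≤m b≤m (inj₂ a≋-b) = trans (m+n≡0⇒m≡0 a a+b≡0) (sym (m+n≡0⇒n≡0 a a+b≡0))
    where
      -- a ≡ −b forces a + b ≡ 0 mod p, and a + b ≤ 2m < p
      a+b≋0 : a + b ≋ 0
      a+b≋0 = begin
        (a + b) % p       ≡⟨ ≋-+ a≋-b (refl {x = b % p}) ⟩
        (-1ₚ * b + b) % p ≡⟨ cong (_% p) (trans (+-comm (-1ₚ * b) b) (trans (*-comm (suc -1ₚ) b)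
                                            (cong (b *_) (sym p≡1+[-1ₚ])))) ⟩
        (0 + b * p) % p   ≡⟨ +*p≋ 0 b ⟩
        0 % p             ∎
        where open ≡-Reasoning
      a+b≡0 : a + b ≡ 0
      a+b≡0 = ≋-<⇒≡ (subst (a + b <_) (sym p≡) (s≤s (+-mono-≤ a≤m b≤m))) 0<p a+b≋0

  sign : ℕ → ℕ
  sign x = if x % p ≤ᵇ m then 1 else -1ₚ

  [p∸1]/2≡m : (p ∸ 1) / 2 ≡ m
  [p∸1]/2≡m = trans (cong (λ z → (z ∸ 1) / 2) p≡) (trans (cong (_/ 2) (m+m≡m*2 m)) (m*n/n≡m m 2))
    where m+m≡m*2 : ∀ m → m + m ≡ m * 2
          m+m≡m*2 = solve-∀

  private
    if-T : ∀ {A : Set} {b} {u v : A} → T b → (if b then u else v) ≡ u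
    if-T {b = true} _ = refl
    if-¬T : ∀ {A : Set} {b} {u v : A} → ¬ T b → (if b then u else v) ≡ v
    if-¬T {b = true}  ¬b = ⊥-elim (¬b _)
    if-¬T {b = false} _  = refl
    R≡ : ∀ {x} → R x p ≡ (if x % p ≤ᵇ m then x % p else p ∸ x % p)
    R≡ {x} = cong (λ t → if x % p ≤ᵇ t then x % p else p ∸ x % p) [p∸1]/2≡m

  data RCase (x : ℕ) : Set where
    low  : x % p ≤ m → R x p ≡ x % p     → sign x ≡ 1   → RCase x
    high : m < x % p → R x p ≡ p ∸ x % p → sign x ≡ -1ₚ → RCase x

  R-case : ∀ x → RCase x
  R-case x with x % p ≤? m
  ... | yes s≤m = low s≤m (trans R≡ (if-T s≤ᵇm)) (if-T s≤ᵇm)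
    where s≤ᵇm : T (x % p ≤ᵇ m)
          s≤ᵇm = ≤⇒≤ᵇ s≤m
  ... | no s≰m = high (≰⇒> s≰m) (trans R≡ (if-¬T s≰ᵇm)) (if-¬T s≰ᵇm)
    where s≰ᵇm : ¬ T (x % p ≤ᵇ m)
          s≰ᵇm = s≰m ∘ ≤ᵇ⇒≤ _ _

  R-≤ : ∀ x → R x p ≤ m
  R-≤ x with R-case x
  ... | low  s≤m R≡s  _ = subst (_≤ m) (sym R≡s) s≤m
  ... | high m<s R≡p∸s _ = subst (_≤ m) (sym R≡p∸s)
                                 (subst (p ∸ x % p ≤_) p∸[1+m]≡m (∸-monoʳ-≤ p m<s))
    where p∸[1+m]≡m : p ∸ suc m ≡ m
          p∸[1+m]≡m = trans (cong (_∸ suc m) p≡) (m+n∸n≡m m m)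

  ≋-sign*R : ∀ x → x ≋ sign x * R x p
  ≋-sign*R x with R-case x
  ... | low  _ R≡s sign≡1 = begin
    x % p                ≡⟨ sym (%≋ x) ⟩
    x % p % p            ≡⟨ cong (_% p) (sym (trans (cong₂ _*_ sign≡1 R≡s) (*-identityˡ (x % p)))) ⟩
    (sign x * R x p) % p ∎
    where open ≡-Reasoning
  ... | high m<s R≡p∸s sign≡-1 = begin
    x % p                       ≡⟨ sym (-1ₚ*-1ₚ*≋ x) ⟩
    (-1ₚ * (-1ₚ * x)) % p       ≡⟨ ≋-*ˡ -1ₚ (≋-*ˡ -1ₚ (sym (%≋ x))) ⟩
    (-1ₚ * (-1ₚ * (x % p))) % p ≡⟨ ≋-*ˡ -1ₚ (sym (∸≋-1ₚ* (<⇒≤ (m%n<n x p)))) ⟩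
    (-1ₚ * (p ∸ x % p)) % p     ≡⟨ cong (_% p) (sym (cong₂ _*_ sign≡-1 R≡p∸s)) ⟩
    (sign x * R x p) % p        ∎
    where open ≡-Reasoning

  sign-±1 : ∀ x → sign x ±≋ 1
  sign-±1 x with R-case x
  ... | low  _ _ sign≡1  = inj₁ (cong (_% p) sign≡1)
  ... | high _ _ sign≡-1 = inj₂ (cong (_% p) (trans sign≡-1 (sym (*-identityʳ -1ₚ))))

  R-± : ∀ x → R x p ±≋ x
  R-± x with R-case x
  ... | low  _ R≡s    _ = inj₁ (trans (cong (_% p) R≡s) (%≋ x))
  ... | high _ R≡p∸s _ = inj₂ (trans (cong (_% p) R≡p∸s)
                                     (trans (∸≋-1ₚ* (<⇒≤ (m%n<n x p))) (≋-*ˡ -1ₚ (%≋ x))))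

  R-small : ∀ {r} → r ≤ m → R r p ≡ r
  R-small {r} r≤m = ±≋-≤⇒≡ (R-≤ r) r≤m (R-± r)

  R-cong : ∀ {a b} → a ±≋ b → R a p ≡ R b p
  R-cong {a} {b} a±≋b = ±≋-≤⇒≡ (R-≤ a) (R-≤ b) (±≋-trans (R-± a) (±≋-trans a±≋b (±≋-sym (R-± b))))

  R-range : ∀ {x} → x ≉0 → 1 ≤ R x p × R x p ≤ m
  R-range {x} x≉0 = n≢0⇒n>0 R≢0 , R-≤ x
    where
      R≢0 : R x p ≢ 0
      R≢0 R≡0 with ±≋-sym (R-± x)
      ... | inj₁ x≋R  = x≉0 (trans x≋R (cong (_% p) R≡0))
      ... | inj₂ x≋-R = x≉0 (trans x≋-R (trans (cong (λ z → (-1ₚ * z) % p) R≡0) (cong (_% p) (*-zeroʳ -1ₚ))))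

  ≤m⇒≉0 : ∀ {r} → 1 ≤ r → r ≤ m → r ≉0
  ≤m⇒≉0 1≤r r≤m = ≉0-< 1≤r (≤-<-trans r≤m m<p)

  sign-≤ : ∀ {y} → y ≤ m → sign y ≡ 1
  sign-≤ {y} y≤m with R-case y
  ... | low  _ _ sign≡1 = sign≡1
  ... | high m<s _ _    = ⊥-elim (<⇒≱ m<s (subst (_≤ m) (sym (m<n⇒m%n≡m (≤-<-trans y≤m m<p))) y≤m))

  sign-> : ∀ {y} → m < y → y < p → sign y ≡ -1ₚ
  sign-> {y} m<y y<p with R-case y
  ... | low s≤m _ _      = ⊥-elim (<⇒≱ m<y (subst (_≤ m) (m<n⇒m%n≡m y<p) s≤m))
  ... | high _ _ sign≡-1 = sign≡-1

  R-*-inverseOn : ∀ {x y} → x * y ≋ 1 → InverseOn m (λ r → R (x * r) p) (λ r → R (y * r) p)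
  R-*-inverseOn {x} {y} xy≋1 = record
    { f-range = λ r 1≤r r≤m → R-range (≉0-* x≉0 (≤m⇒≉0 1≤r r≤m))
    ; g-range = λ r 1≤r r≤m → R-range (≉0-* y≉0 (≤m⇒≉0 1≤r r≤m))
    ; f∘g     = λ r _ r≤m → undo x y xy≋1 r≤m
    ; g∘f     = λ r _ r≤m → undo y x yx≋1 r≤m
    }
    where
      yx≋1 : y * x ≋ 1
      yx≋1 = trans (≡⇒≋ (*-comm y x)) xy≋1
      x≉0 : x ≉0
      x≉0 = inverse-≉0 y yx≋1
      y≉0 : y ≉0
      y≉0 = inverse-≉0 x xy≋1
      undo : ∀ u v {r} → u * v ≋ 1 → r ≤ m → R (u * R (v * r) p) p ≡ r
      undo u v {r} uv≋1 r≤m = begin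
        R (u * R (v * r) p) p ≡⟨ R-cong (±≋-* (inj₁ (refl {x = u % p})) (R-± (v * r))) ⟩
        R (u * (v * r)) p     ≡⟨ R-cong (inj₁ (trans (≡⇒≋ (sym (*-assoc u v r)))
                                                (trans (≋-*ʳ r uv≋1) (≡⇒≋ (*-identityˡ r))))) ⟩
        R r p                 ≡⟨ R-small r≤m ⟩
        r                     ∎
        where open ≡-Reasoning

  ∏-≋ : ∀ n {f g} → (∀ r → f r ≋ g r) → ∏ n f ≋ ∏ n g
  ∏-≋ zero    f≋g = refl
  ∏-≋ (suc n) f≋g = ≋-* (f≋g 1) (∏-≋ n (f≋g ∘ suc))

  ∏-≉0 : ∀ n {f} → (∀ r → 1 ≤ r → r ≤ n → f r ≉0) → ∏ n f ≉0
  ∏-≉0 zero    f≉0 = ≉0-< ≤-refl 1<p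
  ∏-≉0 (suc n) f≉0 = ≉0-* (f≉0 1 ≤-refl (s≤s z≤n)) (∏-≉0 n (λ r 1≤r r≤n → f≉0 (suc r) (s≤s z≤n) (s≤s r≤n)))

  ∏-±1 : ∀ n {f} → (∀ r → f r ±≋ 1) → ∏ n f ±≋ 1
  ∏-±1 zero    f±1 = inj₁ refl
  ∏-±1 (suc n) f±1 = ±≋-* (f±1 1) (∏-±1 n (f±1 ∘ suc))

  -- Gauss' lemma: the residues R (x * r), 1 ≤ r ≤ m, permute 1, …, m, and x * r ≋ sign (x * r) * R (x * r) p.
  gauss-lemma : ∀ {x} → x ≉0 → x ^ m ≋ ∏ m (λ r → sign (x * r))
  gauss-lemma {x} x≉0 = *-cancelʳ-≋ m!≉0 (begin
    (x ^ m * m!) % p                           ≡⟨ cong (λ z → (z * m!) % p) (sym (∏-const m x)) ⟩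
    (∏ m (λ _ → x) * m!) % p                   ≡⟨ cong (_% p) (sym (∏-distrib m (λ _ → x) id)) ⟩
    ∏ m (λ r → x * r) % p                      ≡⟨ ∏-≋ m (λ r → ≋-sign*R (x * r)) ⟩
    ∏ m (λ r → sign (x * r) * R (x * r) p) % p ≡⟨ cong (_% p) (∏-distrib m (λ r → sign (x * r)) (λ r → R (x * r) p)) ⟩
    (∏ m (λ r → sign (x * r)) * ∏ m (λ r → R (x * r) p)) % p
                                               ≡⟨ cong (λ z → (∏ m (λ r → sign (x * r)) * z) % p)
                                                       (∏-reindex m (R-*-inverseOn {x} (proj₂ (inverse x≉0))) id) ⟩
    (∏ m (λ r → sign (x * r)) * m!) % p        ∎)
    where
      open ≡-Reasoning
      m! : ℕ
      m! = ∏ m id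
      m!≉0 : m! ≉0
      m!≉0 = ∏-≉0 m (λ _ → ≤m⇒≉0)

  euler-criterion : ∀ {x} → x ≉0 → x ^ m ±≋ 1
  euler-criterion {x} x≉0 = ±≋-trans (inj₁ (gauss-lemma x≉0)) (∏-±1 m {λ r → sign (x * r)} (λ r → sign-±1 (x * r)))

  infixl 6 _−ₚ_
  _−ₚ_ : ℕ → ℕ → ℕ
  a −ₚ b = a + -1ₚ * b

  −ₚ≋0⇒≋ : ∀ {a b} → a −ₚ b ≋ 0 → a ≋ b
  −ₚ≋0⇒≋ {b = b} a−b≋0 = trans (+≋0⇒≋-1ₚ* a−b≋0) (-1ₚ*-1ₚ*≋ b)

  −ₚ-swap : ∀ a b → b −ₚ a ≋ -1ₚ * (a −ₚ b)
  −ₚ-swap a b = sym (begin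
    (-1ₚ * (a + -1ₚ * b)) % p       ≡⟨ cong (_% p) (distribute a b -1ₚ) ⟩
    (-1ₚ * a + (-1ₚ * -1ₚ) * b) % p ≡⟨ ≋-+ˡ (-1ₚ * a) (trans (≋-*ʳ b -1ₚ²≋1) (≡⇒≋ (*-identityˡ b))) ⟩
    (-1ₚ * a + b) % p               ≡⟨ cong (_% p) (+-comm (-1ₚ * a) b) ⟩
    (b + -1ₚ * a) % p               ∎)
    where open ≡-Reasoning
          distribute : ∀ a b q → q * (a + q * b) ≡ q * a + (q * q) * b
          distribute = solve-∀

  difference-of-squares : ∀ a b → a * a −ₚ b * b ≋ (a −ₚ b) * (a + b)
  difference-of-squares a b = sym (begin
    ((a + -1ₚ * b) * (a + b)) % p                   ≡⟨ cong (_% p) (expand a b -1ₚ) ⟩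
    (a * a + -1ₚ * (b * b) + (a * b) * suc -1ₚ) % p ≡⟨ cong (λ z → (a * a + -1ₚ * (b * b) + (a * b) * z) % p) p≡1+[-1ₚ] ⟨
    (a * a + -1ₚ * (b * b) + (a * b) * p) % p       ≡⟨ +*p≋ (a * a + -1ₚ * (b * b)) (a * b) ⟩
    (a * a + -1ₚ * (b * b)) % p                     ∎)
    where open ≡-Reasoning
          expand : ∀ a b q → (a + q * b) * (a + b) ≡ a * a + q * (b * b) + (a * b) * suc q
          expand = solve-∀

  QR : ℕ → Bool
  QR x = does (x ^ m % p ≟ 1)

  data QRView (x : ℕ) : Set where
    residue    : QR x ≡ true  → x ^ m ≋ 1   → QRView x
    nonresidue : QR x ≡ false → x ^ m ≋ -1ₚ → QRView x

  QR-true : ∀ {x} → x ^ m ≋ 1 → QR x ≡ true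
  QR-true {x} x^m≋1 = dec-true (x ^ m % p ≟ 1) (trans x^m≋1 (m<n⇒m%n≡m 1<p))

  -1ₚ≢1 : -1ₚ ≢ 1
  -1ₚ≢1 -1ₚ≡1 = m+m≢1 m (trans (cong (_∸ 1) (sym p≡)) -1ₚ≡1)
    where m+m≢1 : ∀ n → n + n ≢ 1
          m+m≢1 (suc n) eq = 1+n≢0 (trans (sym (+-suc n n)) (suc-injective eq))

  ≋-1ₚ⇒%≢1 : ∀ {y} → y ≋ -1ₚ → y % p ≢ 1
  ≋-1ₚ⇒%≢1 y≋-1 y%p≡1 = -1ₚ≢1 (trans (sym (m<n⇒m%n≡m -1ₚ<p)) (trans (sym y≋-1) y%p≡1))

  QR-false : ∀ {x} → x ^ m ≋ -1ₚ → QR x ≡ false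
  QR-false {x} x^m≋-1 = dec-false (x ^ m % p ≟ 1) (≋-1ₚ⇒%≢1 x^m≋-1)

  QR-view : ∀ {x} → x ≉0 → QRView x
  QR-view {x} x≉0 = view (euler-criterion x≉0)
    where
      view : x ^ m ±≋ 1 → QRView x
      view (inj₁ x^m≋1)  = residue (QR-true {x} x^m≋1) x^m≋1
      view (inj₂ x^m≋-1) = nonresidue (QR-false {x} x^m≋-1′) x^m≋-1′
        where x^m≋-1′ : x ^ m ≋ -1ₚ
              x^m≋-1′ = trans x^m≋-1 (≡⇒≋ (*-identityʳ -1ₚ))

  QR-cong : ∀ {a b} → a ≋ b → QR a ≡ QR b
  QR-cong a≋b = cong (λ z → does (z ≟ 1)) (≋-^ m a≋b)

  QR-* : ∀ {a b} → a ≉0 → b ≉0 → QR (a * b) ≡ not (QR a xor QR b)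
  QR-* {a} {b} a≉0 b≉0 = combine (QR-view a≉0) (QR-view b≉0)
    where
      [ab]^m≡ : (a * b) ^ m ≋ a ^ m * b ^ m
      [ab]^m≡ = ≡⇒≋ (^-distribʳ-* a b m)
      from : ∀ {u v} → QR a ≡ u → QR b ≡ v → QR (a * b) ≡ not (u xor v) → QR (a * b) ≡ not (QR a xor QR b)
      from QRa QRb eq = trans eq (cong₂ (λ u v → not (u xor v)) (sym QRa) (sym QRb))
      combine : QRView a → QRView b → QR (a * b) ≡ not (QR a xor QR b)
      combine (residue QRa eqa) (residue QRb eqb) =
        from QRa QRb (QR-true {a * b} (trans [ab]^m≡ (≋-* eqa eqb)))
      combine (residue QRa eqa) (nonresidue QRb eqb) =
        from QRa QRb (QR-false {a * b} (trans [ab]^m≡ (trans (≋-* eqa eqb) (≡⇒≋ (*-identityˡ -1ₚ)))))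
      combine (nonresidue QRa eqa) (residue QRb eqb) =
        from QRa QRb (QR-false {a * b} (trans [ab]^m≡ (trans (≋-* eqa eqb) (≡⇒≋ (*-identityʳ -1ₚ)))))
      combine (nonresidue QRa eqa) (nonresidue QRb eqb) =
        from QRa QRb (QR-true {a * b} (trans [ab]^m≡ (trans (≋-* eqa eqb) -1ₚ²≋1)))

  QR-² : ∀ {y} → y ≉0 → QR (y * y) ≡ true
  QR-² {y} y≉0 = trans (QR-* y≉0 y≉0) (not-x-xor-x (QR y))
    where not-x-xor-x : ∀ b → not (b xor b) ≡ true
          not-x-xor-x true  = refl
          not-x-xor-x false = refl

  x*x^m±≋x : ∀ {x} → x ≉0 → x * x ^ m ±≋ x
  x*x^m±≋x {x} x≉0 = ±≋-trans (±≋-* (inj₁ (refl {x = x % p})) (euler-criterion x≉0)) (inj₁ (≡⇒≋ (*-identityʳ x)))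

  QR-square-* : ∀ {y x} → y ≉0 → x ≉0 → QR (y * y * x) ≡ QR x
  QR-square-* {y} {x} y≉0 x≉0 =
    trans (QR-* (≉0-* y≉0 y≉0) x≉0) (trans (cong (λ b → not (b xor QR x)) (QR-² y≉0)) (not-involutive (QR x)))

  infix 4 _≋0?
  _≋0? : ∀ x → Dec (x ≋ 0)
  x ≋0? = x % p ≟ 0 % p

  χ : ℕ → ℤ
  χ x = if does (x ≋0?) then 0ℤ else ±1 (QR x)

  χ-≋0 : ∀ {x} → x ≋ 0 → χ x ≡ 0ℤ
  χ-≋0 {x} x≋0 = cong (λ b → if b then 0ℤ else ±1 (QR x)) (dec-true (x ≋0?) x≋0)

  χ-≉0 : ∀ {x} → x ≉0 → χ x ≡ ±1 (QR x)
  χ-≉0 {x} x≉0 = cong (λ b → if b then 0ℤ else ±1 (QR x)) (dec-false (x ≋0?) x≉0)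

  χ-cong : ∀ {a b} → a ≋ b → χ a ≡ χ b
  χ-cong a≋b = cong₂ (λ s b → if does (s ≟ 0 % p) then 0ℤ else ±1 b) a≋b (QR-cong a≋b)

  χ-* : ∀ a b → χ (a * b) ≡ χ a *ℤ χ b
  χ-* a b = cases (a ≋0?) (b ≋0?)
    where
      cases : Dec (a ≋ 0) → Dec (b ≋ 0) → χ (a * b) ≡ χ a *ℤ χ b
      cases (yes a≋0) _ = begin
        χ (a * b)  ≡⟨ χ-≋0 (≋-*ʳ b a≋0) ⟩
        0ℤ         ≡⟨ cong (_*ℤ χ b) (χ-≋0 a≋0) ⟨
        χ a *ℤ χ b ∎
        where open ≡-Reasoning
      cases (no a≉0) (yes b≋0) = begin
        χ (a * b)  ≡⟨ χ-≋0 (trans (≋-*ˡ a b≋0) (cong (_% p) (*-zeroʳ a))) ⟩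
        0ℤ         ≡⟨ ℤₚ.*-zeroʳ (χ a) ⟨
        χ a *ℤ 0ℤ  ≡⟨ cong (χ a *ℤ_) (χ-≋0 b≋0) ⟨
        χ a *ℤ χ b ∎
        where open ≡-Reasoning
      cases (no a≉0) (no b≉0) = begin
        χ (a * b)                ≡⟨ χ-≉0 (≉0-* a≉0 b≉0) ⟩
        ±1 (QR (a * b))          ≡⟨ cong ±1 (QR-* a≉0 b≉0) ⟩
        ±1 (not (QR a xor QR b)) ≡⟨ ±1-not-xor (QR a) (QR b) ⟩
        ±1 (QR a) *ℤ ±1 (QR b)   ≡⟨ cong₂ _*ℤ_ (χ-≉0 a≉0) (χ-≉0 b≉0) ⟨
        χ a *ℤ χ b               ∎
        where open ≡-Reasoning

  χ-² : ∀ {y} → y ≉0 → χ (y * y) ≡ 1ℤ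
  χ-² y≉0 = trans (χ-≉0 (≉0-* y≉0 y≉0)) (cong ±1 (QR-² y≉0))

  χ-1 : χ 1 ≡ 1ℤ
  χ-1 = trans (χ-≉0 (≉0-< ≤-refl 1<p)) (cong ±1 (QR-true {1} (≡⇒≋ (^-zeroˡ m))))

  χ-p : χ p ≡ 0ℤ
  χ-p = χ-≋0 p≋0

  -1ₚ≡m+m : -1ₚ ≡ m + m
  -1ₚ≡m+m = cong (_∸ 1) p≡

  ≤-1ₚ⇒<p : ∀ {w} → w ≤ -1ₚ → w < p
  ≤-1ₚ⇒<p w≤-1 = subst (_ <_) (sym p≡1+[-1ₚ]) (s≤s w≤-1)

  -- r ↦ m + 1 ∸ r reverses 1, …, m, and −r ≋ p ∸ r = m + (m + 1 ∸ r)
  ∑-±-pairs : ∀ (g : ℕ → ℤ) → (∀ {a b} → a ≋ b → g a ≡ g b) →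
              ∑ℤ m (λ r → g r +ℤ g (-1ₚ * r)) ≡ ∑ℤ -1ₚ g
  ∑-±-pairs g g-cong = begin
    ∑ℤ m (λ r → g r +ℤ g (-1ₚ * r))    ≡⟨ ∑ℤ-distrib m g (λ r → g (-1ₚ * r)) ⟩
    ∑ℤ m g +ℤ ∑ℤ m (λ r → g (-1ₚ * r)) ≡⟨ cong (λ z → ∑ℤ m g +ℤ z) negatives ⟩
    ∑ℤ m g +ℤ ∑ℤ m (λ r → g (m + r))   ≡⟨ ∑ℤ-+ m m g ⟨
    ∑ℤ (m + m) g                       ≡⟨ cong (λ n → ∑ℤ n g) -1ₚ≡m+m ⟨
    ∑ℤ -1ₚ g                           ∎
    where
      open ≡-Reasoning
      rev : ℕ → ℕ
      rev r = suc m ∸ r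
      rev-inverseOn : InverseOn m rev rev
      rev-inverseOn = record
        { f-range = range ; g-range = range ; f∘g = involutive ; g∘f = involutive }
        where
          range : ∀ r → 1 ≤ r → r ≤ m → 1 ≤ rev r × rev r ≤ m
          range (suc r) _ r≤m = m<n⇒0<n∸m r≤m , m∸n≤m m r
          involutive : ∀ r → 1 ≤ r → r ≤ m → rev (rev r) ≡ r
          involutive r _ r≤m = m∸[m∸n]≡n (m≤n⇒m≤1+n r≤m)
      m+rev : ∀ {r} → r ≤ m → m + rev r ≡ p ∸ r
      m+rev {r} r≤m = trans (sym (+-∸-assoc m (m≤n⇒m≤1+n r≤m))) (cong (_∸ r) (trans (+-suc m m) (sym p≡)))
      negatives : ∑ℤ m (λ r → g (-1ₚ * r)) ≡ ∑ℤ m (λ r → g (m + r))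
      negatives = trans (∑ℤ-cong m (λ r _ r≤m → g-cong (trans (sym (∸≋-1ₚ* (≤-trans r≤m (<⇒≤ m<p))))
                                                               (≡⇒≋ (sym (m+rev r≤m))))))
                        (∑ℤ-reindex m rev-inverseOn (λ r → g (m + r)))

  private
    invert : ∀ {w} → Dec (w ≋ 0) → ℕ
    invert (yes _)  = 0
    invert (no w≉0) = proj₁ (inverse w≉0) % p

    *-invert : ∀ {w} (w≋0? : Dec (w ≋ 0)) → w ≉0 → w * invert w≋0? ≋ 1
    *-invert (yes w≋0) w≉0 = ⊥-elim (w≉0 w≋0)
    *-invert {w} (no _) w≉0 = trans (≋-*ˡ w (%≋ (proj₁ (inverse w≉0)))) (proj₂ (inverse w≉0))

    invert-< : ∀ {w} (w≋0? : Dec (w ≋ 0)) → invert w≋0? < p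
    invert-< (yes _) = 0<p
    invert-< (no _)  = m%n<n _ p

  inv : ℕ → ℕ
  inv w = invert (w ≋0?)

  *-inv : ∀ {w} → w ≉0 → w * inv w ≋ 1
  *-inv {w} = *-invert (w ≋0?)

  inv-inverseOn : InverseOn -1ₚ inv inv
  inv-inverseOn = record { f-range = range ; g-range = range ; f∘g = involutive ; g∘f = involutive }
    where
      ≉0⇒≥1 : ∀ {y} → y ≉0 → 1 ≤ y
      ≉0⇒≥1 {zero}  0≉0 = ⊥-elim (0≉0 refl)
      ≉0⇒≥1 {suc y} _   = s≤s z≤n
      <p⇒≤-1ₚ : ∀ {w} → w < p → w ≤ -1ₚ
      <p⇒≤-1ₚ w<p = ≤-pred (subst (_ <_) p≡1+[-1ₚ] w<p)
      range : ∀ w → 1 ≤ w → w ≤ -1ₚ → 1 ≤ inv w × inv w ≤ -1ₚ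
      range w 1≤w w≤-1 = ≉0⇒≥1 (inverse-≉0 w (*-inv (≉0-< 1≤w (≤-1ₚ⇒<p w≤-1)))) , <p⇒≤-1ₚ (invert-< (w ≋0?))
      involutive : ∀ w → 1 ≤ w → w ≤ -1ₚ → inv (inv w) ≡ w
      involutive w 1≤w w≤-1 = ≋-<⇒≡ (invert-< (inv w ≋0?)) (≤-1ₚ⇒<p w≤-1)
        (*-cancelʳ-≋ inv-w≉0 (trans (≡⇒≋ (*-comm (inv (inv w)) (inv w))) (trans (*-inv inv-w≉0) (sym (*-inv w≉0)))))
        where
          w≉0 : w ≉0
          w≉0 = ≉0-< 1≤w (≤-1ₚ⇒<p w≤-1)
          inv-w≉0 : inv w ≉0
          inv-w≉0 = inverse-≉0 w (*-inv w≉0)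

  ∑χ∘suc : 1ℤ +ℤ ∑ℤ -1ₚ (χ ∘ suc) ≡ ∑ℤ -1ₚ χ
  ∑χ∘suc = begin
    1ℤ +ℤ ∑ℤ -1ₚ (χ ∘ suc)  ≡⟨ cong (_+ℤ ∑ℤ -1ₚ (χ ∘ suc)) χ-1 ⟨
    ∑ℤ (suc -1ₚ) χ          ≡⟨ ∑ℤ-snoc -1ₚ χ ⟩
    ∑ℤ -1ₚ χ +ℤ χ (suc -1ₚ) ≡⟨ cong (λ z → ∑ℤ -1ₚ χ +ℤ χ z) p≡1+[-1ₚ] ⟨
    ∑ℤ -1ₚ χ +ℤ χ p         ≡⟨ cong (∑ℤ -1ₚ χ +ℤ_) χ-p ⟩
    ∑ℤ -1ₚ χ +ℤ 0ℤ          ≡⟨ ℤₚ.+-identityʳ _ ⟩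
    ∑ℤ -1ₚ χ                ∎
    where open ≡-Reasoning

  -- substituting w ↦ w⁻¹: χ (w⁻¹) χ (1 + w⁻¹) = χ (w²) χ (w⁻¹ (1 + w⁻¹)) = χ (1 + w)
  ∑χ*χ∘suc : ∑ℤ -1ₚ (λ w → χ w *ℤ χ (suc w)) ≡ ∑ℤ -1ₚ (χ ∘ suc)
  ∑χ*χ∘suc = trans (sym (∑ℤ-reindex -1ₚ inv-inverseOn (λ w → χ w *ℤ χ (suc w)))) (∑ℤ-cong -1ₚ substitute)
    where
      substitute : ∀ w → 1 ≤ w → w ≤ -1ₚ → χ (inv w) *ℤ χ (suc (inv w)) ≡ χ (suc w)
      substitute w 1≤w w≤-1 = begin
        χ v *ℤ χ (1 + v)             ≡⟨ χ-* v (1 + v) ⟨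
        χ (v * (1 + v))              ≡⟨ ℤₚ.*-identityˡ _ ⟨
        1ℤ *ℤ χ (v * (1 + v))        ≡⟨ cong (_*ℤ χ (v * (1 + v))) (χ-² w≉0) ⟨
        χ (w * w) *ℤ χ (v * (1 + v)) ≡⟨ χ-* (w * w) (v * (1 + v)) ⟨
        χ (w * w * (v * (1 + v)))    ≡⟨ χ-cong (trans (≡⇒≋ (regroup w v))
                                             (≋-+ (≋-*ʳ w wv≋1) (≋-* wv≋1 wv≋1))) ⟩
        χ (1 * w + 1 * 1)            ≡⟨ cong χ (trans (+-comm (1 * w) 1) (cong suc (*-identityˡ w))) ⟩
        χ (1 + w)                    ∎
        where
          open ≡-Reasoning
          v : ℕ
          v = inv w
          w≉0 : w ≉0
          w≉0 = ≉0-< 1≤w (≤-1ₚ⇒<p w≤-1)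
          wv≋1 : w * v ≋ 1
          wv≋1 = *-inv w≉0
          regroup : ∀ w v → w * w * (v * (1 + v)) ≡ (w * v) * w + (w * v) * (w * v)
          regroup = solve-∀

module ThreeModFour {p : ℕ} (k : ℕ) (p≡ : p ≡ 3 + 4 * k) (prime : Prime p) where

  m : ℕ
  m = suc (2 * k)

  p≡1+m+m : p ≡ suc (m + m)
  p≡1+m+m = trans p≡ (3+4k≡ k)
    where 3+4k≡ : ∀ k → 3 + 4 * k ≡ suc (suc (2 * k) + suc (2 * k))
          3+4k≡ = solve-∀

  open OddPrime m p≡1+m+m prime

  -1ₚ^even : ∀ j → -1ₚ ^ (j + j) ≋ 1
  -1ₚ^even zero    = refl
  -1ₚ^even (suc j) = trans (≡⇒≋ (trans (cong (-1ₚ ^_) (cong suc (+-suc j j))) (sym (*-assoc -1ₚ -1ₚ _))))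
                           (≋-* -1ₚ²≋1 (-1ₚ^even j))

  -1ₚ^m : -1ₚ ^ m ≋ -1ₚ
  -1ₚ^m = trans (≋-*ˡ -1ₚ (subst (λ n → -1ₚ ^ n ≋ 1) (cong (k +_) (sym (+-identityʳ k))) (-1ₚ^even k)))
                (≡⇒≋ (*-identityʳ -1ₚ))

  QR-1ₚ : QR -1ₚ ≡ false
  QR-1ₚ = QR-false { -1ₚ} -1ₚ^m

  σ : ℕ → ℕ
  σ i = R (i * i) p

  τ : ℕ → ℕ
  τ r = R (r ^ suc k) p

  -- both squaring and raising to k + 1 compose to x ↦ x ^ (m + 1) ≋ ±x on the nonzero residues
  σ-inverseOn : InverseOn m σ τ
  σ-inverseOn = record
    { f-range = λ i 1≤i i≤m → R-range (≉0-* (≤m⇒≉0 1≤i i≤m) (≤m⇒≉0 1≤i i≤m))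
    ; g-range = λ r 1≤r r≤m → R-range (≉0-^ (suc k) (≤m⇒≉0 1≤r r≤m))
    ; f∘g     = σ∘τ
    ; g∘f     = τ∘σ
    }
    where
      x^[1+k]²≡x*x^m : ∀ x → x ^ suc k * x ^ suc k ≡ x * x ^ m
      x^[1+k]²≡x*x^m x = trans (sym (^-distribˡ-+-* x (suc k) (suc k))) (cong (x ^_) (1+k+1+k≡ k))
        where 1+k+1+k≡ : ∀ k → suc k + suc k ≡ suc (suc (2 * k))
              1+k+1+k≡ = solve-∀
      σ∘τ : ∀ r → 1 ≤ r → r ≤ m → σ (τ r) ≡ r
      σ∘τ r 1≤r r≤m = begin
        R (τ r * τ r) p             ≡⟨ R-cong (inj₁ (±≋⇒≋² (R-± (r ^ suc k)))) ⟩
        R (r ^ suc k * r ^ suc k) p ≡⟨ cong (λ z → R z p) (x^[1+k]²≡x*x^m r) ⟩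
        R (r * r ^ m) p             ≡⟨ R-cong (x*x^m±≋x (≤m⇒≉0 1≤r r≤m)) ⟩
        R r p                       ≡⟨ R-small r≤m ⟩
        r                           ∎
        where open ≡-Reasoning
      τ∘σ : ∀ i → 1 ≤ i → i ≤ m → τ (σ i) ≡ i
      τ∘σ i 1≤i i≤m = begin
        R (σ i ^ suc k) p     ≡⟨ R-cong (±≋-^ (suc k) (R-± (i * i))) ⟩
        R ((i * i) ^ suc k) p ≡⟨ cong (λ z → R z p) (trans (^-distribʳ-* i i (suc k)) (x^[1+k]²≡x*x^m i)) ⟩
        R (i * i ^ m) p       ≡⟨ R-cong (x*x^m±≋x (≤m⇒≉0 1≤i i≤m)) ⟩
        R i p                 ≡⟨ R-small i≤m ⟩
        i                     ∎
        where open ≡-Reasoning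

  σ-injective : ∀ {i j} → 1 ≤ i → i ≤ m → 1 ≤ j → j ≤ m → σ i ≡ σ j → i ≡ j
  σ-injective {i} {j} 1≤i i≤m 1≤j j≤m σi≡σj =
    trans (sym (g∘f i 1≤i i≤m)) (trans (cong τ σi≡σj) (g∘f j 1≤j j≤m))
    where open InverseOn σ-inverseOn

  2≉0 : 2 ≉0
  2≉0 = ≉0-< (s≤s z≤n) (subst (2 <_) (sym p≡) (s≤s (s≤s (s≤s z≤n))))

  -- Gauss' lemma for x = 2: 2r ≤ m exactly for the k values r ≤ k
  2^m≋-1ₚ^[1+k] : 2 ^ m ≋ -1ₚ ^ suc k
  2^m≋-1ₚ^[1+k] = trans (gauss-lemma 2≉0) (≡⇒≋ (begin
    ∏ m (λ r → sign (2 * r))                                        ≡⟨ cong (λ n → ∏ n (λ r → sign (2 * r))) (m≡k+1+k k) ⟩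
    ∏ (k + suc k) (λ r → sign (2 * r))                              ≡⟨ ∏-+ k (suc k) (λ r → sign (2 * r)) ⟩
    ∏ k (λ r → sign (2 * r)) * ∏ (suc k) (λ r → sign (2 * (k + r))) ≡⟨ cong₂ _*_ first-k last-1+k ⟩
    1 * -1ₚ ^ suc k                                                 ≡⟨ *-identityˡ _ ⟩
    -1ₚ ^ suc k                                                     ∎))
    where
      open ≡-Reasoning
      m≡k+1+k : ∀ k → suc (2 * k) ≡ k + suc k
      m≡k+1+k = solve-∀
      first-k : ∏ k (λ r → sign (2 * r)) ≡ 1
      first-k = trans (∏-cong k (λ r _ r≤k → sign-≤ (m≤n⇒m≤1+n (*-monoʳ-≤ 2 r≤k)))) (trans (∏-const k 1) (^-zeroˡ k))
      last-1+k : ∏ (suc k) (λ r → sign (2 * (k + r))) ≡ -1ₚ ^ suc k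
      last-1+k = trans (∏-cong (suc k) (λ r 1≤r r≤1+k → sign-> (m<2[k+r] 1≤r) (2[k+r]<p r≤1+k))) (∏-const (suc k) -1ₚ)
        where
          m<2[k+r] : ∀ {r} → 1 ≤ r → m < 2 * (k + r)
          m<2[k+r] {r} 1≤r = subst (_≤ 2 * (k + r)) (2[k+1]≡ k) (*-monoʳ-≤ 2 (+-monoʳ-≤ k 1≤r))
            where 2[k+1]≡ : ∀ k → 2 * (k + 1) ≡ suc (suc (2 * k))
                  2[k+1]≡ = solve-∀
          2[k+r]<p : ∀ {r} → r ≤ suc k → 2 * (k + r) < p
          2[k+r]<p {r} r≤1+k = subst (2 * (k + r) <_) (sym p≡) (s≤s (subst (2 * (k + r) ≤_) (2[k+1+k]≡ k)
                                                                      (*-monoʳ-≤ 2 (+-monoʳ-≤ k r≤1+k))))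
            where 2[k+1+k]≡ : ∀ k → 2 * (k + suc k) ≡ 2 + 4 * k
                  2[k+1+k]≡ = solve-∀

  QR-2-even : ∀ {j} → k ≡ j + j → QR 2 ≡ false
  QR-2-even {j} k≡j+j = QR-false {2} (trans 2^m≋-1ₚ^[1+k] (trans (≋-*ˡ -1ₚ -1ₚ^k≋1) (≡⇒≋ (*-identityʳ -1ₚ))))
    where -1ₚ^k≋1 : -1ₚ ^ k ≋ 1
          -1ₚ^k≋1 = subst (λ n → -1ₚ ^ n ≋ 1) (sym k≡j+j) (-1ₚ^even j)

  QR-2-odd : ∀ {j} → k ≡ suc (j + j) → QR 2 ≡ true
  QR-2-odd {j} k≡1+j+j = QR-true {2} (trans 2^m≋-1ₚ^[1+k] (subst (λ n → -1ₚ ^ n ≋ 1) 1+k≡ (-1ₚ^even (suc j))))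
    where 1+k≡ : suc j + suc j ≡ suc k
          1+k≡ = trans (cong suc (+-suc j j)) (cong suc (sym k≡1+j+j))

  -1ₚ≉0 : -1ₚ ≉0
  -1ₚ≉0 = ≉0-< (subst (1 ≤_) (sym -1ₚ≡m+m) (s≤s z≤n)) -1ₚ<p

  QR-−1ₚ* : ∀ {a} → a ≉0 → QR (-1ₚ * a) ≡ not (QR a)
  QR-−1ₚ* {a} a≉0 = trans (QR-* -1ₚ≉0 a≉0) (cong (λ b → not (b xor QR a)) QR-1ₚ)

  square-difference-≉0 : ∀ {i j} → 1 ≤ i → i ≤ m → 1 ≤ j → j ≤ m → i ≢ j → j * j −ₚ i * i ≉0
  square-difference-≉0 1≤i i≤m 1≤j j≤m i≢j j²−i²≋0 =
    i≢j (sym (σ-injective 1≤j j≤m 1≤i i≤m (R-cong (inj₁ (−ₚ≋0⇒≋ j²−i²≋0)))))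

  sum-of-squares-≉0 : ∀ {i j} → i ≉0 → j ≉0 → i * i + j * j ≉0
  sum-of-squares-≉0 {i} {j} i≉0 j≉0 i²+j²≋0 = false≢true (begin
    false              ≡⟨⟩
    not true           ≡⟨ cong not (QR-² j≉0) ⟨
    not (QR (j * j))   ≡⟨ QR-−1ₚ* (≉0-* j≉0 j≉0) ⟨
    QR (-1ₚ * (j * j)) ≡⟨ QR-cong (+≋0⇒≋-1ₚ* i²+j²≋0) ⟨
    QR (i * i)         ≡⟨ QR-² i≉0 ⟩
    true               ∎)
    where open ≡-Reasoning
          false≢true : false ≢ true
          false≢true ()

  lt⊕QR : ℕ → ℕ → Bool
  lt⊕QR x y = lt x y xor QR (y * y −ₚ x * x)

  lt⊕QR-sym : ∀ x y → 1 ≤ x → x ≤ m → 1 ≤ y → y ≤ m → lt⊕QR x y ≡ lt⊕QR y x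
  lt⊕QR-sym x y 1≤x x≤m 1≤y y≤m with x ≟ y
  ... | yes refl = refl
  ... | no x≢y = begin
    lt x y xor QR (y * y −ₚ x * x)               ≡⟨ cong₂ _xor_ (lt-flip x≢y) (QR-cong (−ₚ-swap (x * x) (y * y))) ⟩
    not (lt y x) xor QR (-1ₚ * (x * x −ₚ y * y)) ≡⟨ cong (not (lt y x) xor_) (QR-−1ₚ* (square-difference-≉0 1≤y y≤m 1≤x x≤m (x≢y ∘ sym))) ⟩
    not (lt y x) xor not (QR (x * x −ₚ y * y))   ≡⟨ not-xor-not (lt y x) _ ⟩
    lt y x xor QR (x * x −ₚ y * y)               ∎
    where open ≡-Reasoning
          not-xor-not : ∀ a b → not a xor not b ≡ a xor b
          not-xor-not true  b = refl
          not-xor-not false b = not-involutive b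

  -- σ j² − σ i² ≋ (j² − i²) (j² + i²) ties the two lt⊕QR terms to QR (i² + j²)
  inversion-xor : ∀ i j → 1 ≤ i → i < j → j ≤ m →
                  lt (σ j) (σ i) ≡ lt⊕QR i j xor lt⊕QR (σ i) (σ j) xor not (QR (i * i + j * j))
  inversion-xor i j 1≤i i<j j≤m = begin
    lt (σ j) (σ i)                                   ≡⟨ lt-flip (i≢j ∘ sym ∘ σ-injective 1≤j j≤m 1≤i i≤m) ⟩
    not L                                            ≡⟨ xor-identity A L C ⟩
    (true xor A) xor (L xor not (A xor C)) xor not C ≡⟨ cong₂ (λ u v → (u xor A) xor (L xor v) xor not C)
                                                              (sym (dec-true (i <? j) i<j)) (sym QR[σj²−σi²]) ⟩
    lt⊕QR i j xor lt⊕QR (σ i) (σ j) xor not C        ∎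
    where
      open ≡-Reasoning
      i≤m : i ≤ m
      i≤m = <⇒≤ (<-≤-trans i<j j≤m)
      1≤j : 1 ≤ j
      1≤j = <⇒≤ (≤-<-trans 1≤i i<j)
      i≢j : i ≢ j
      i≢j = <⇒≢ i<j
      A C L : Bool
      A = QR (j * j −ₚ i * i)
      C = QR (i * i + j * j)
      L = lt (σ i) (σ j)
      xor-identity : ∀ a l c → not l ≡ (true xor a) xor (l xor not (a xor c)) xor not c
      xor-identity true  true  true  = refl
      xor-identity true  true  false = refl
      xor-identity true  false true  = refl
      xor-identity true  false false = refl
      xor-identity false true  true  = refl
      xor-identity false true  false = refl
      xor-identity false false true  = refl
      xor-identity false false false = refl
      QR[σj²−σi²] : QR (σ j * σ j −ₚ σ i * σ i) ≡ not (A xor C)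
      QR[σj²−σi²] = begin
        QR (σ j * σ j −ₚ σ i * σ i)
          ≡⟨ QR-cong (≋-+ (±≋⇒≋² (R-± (j * j))) (≋-*ˡ -1ₚ (±≋⇒≋² (R-± (i * i))))) ⟩
        QR ((j * j) * (j * j) −ₚ (i * i) * (i * i))
          ≡⟨ QR-cong (difference-of-squares (j * j) (i * i)) ⟩
        QR ((j * j −ₚ i * i) * (j * j + i * i))
          ≡⟨ QR-* (square-difference-≉0 1≤i i≤m 1≤j j≤m i≢j) (sum-of-squares-≉0 j≉0 i≉0) ⟩
        not (A xor QR (j * j + i * i))
          ≡⟨ cong (λ z → not (A xor QR z)) (+-comm (j * j) (i * i)) ⟩
        not (A xor C) ∎
        where i≉0 : i ≉0
              i≉0 = ≤m⇒≉0 1≤i i≤m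
              j≉0 : j ≉0
              j≉0 = ≤m⇒≉0 1≤j j≤m

  inversions : ℕ
  inversions = ∑pairs m (λ i j → 𝟙 (lt (σ j) (σ i)))

  nonresidue-pairs : ℕ
  nonresidue-pairs = ∑pairs m (λ i j → 𝟙 (not (QR (i * i + j * j))))

  -- summing inversion-xor over the pairs, the two lt⊕QR sums agree because σ permutes 1, …, m
  inversions-parity : inversions % 2 ≡ nonresidue-pairs % 2
  inversions-parity = %2-≡-of-even-sum inversions nonresidue-pairs A W (begin
    inversions + (A + A + Nr)                           ≡⟨ cong (λ z → inversions + (A + z + Nr)) A≡B ⟩
    inversions + (A + B + Nr)                           ≡⟨ cong (inversions +_) count-split ⟨
    inversions + ∑pairs m count                         ≡⟨ ∑pairs-distrib m (λ i j → 𝟙 (lt (σ j) (σ i))) count ⟨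
    ∑pairs m (λ i j → 𝟙 (lt (σ j) (σ i)) + count i j)  ≡⟨ ∑pairs-cong m (λ i j 1≤i i<j j≤m →
                                                             trans (cong (λ z → 𝟙 z + count i j) (inversion-xor i j 1≤i i<j j≤m))
                                                                   (𝟙-xor₃ (a i j) (b i j) (not (QR (i * i + j * j))))) ⟩
    ∑pairs m (λ i j → half i j + half i j)              ≡⟨ ∑pairs-distrib m half half ⟩
    W + W                                  ∎)
    where
      open ≡-Reasoning
      a b : ℕ → ℕ → Bool
      a i j = lt⊕QR i j
      b i j = lt⊕QR (σ i) (σ j)
      c : ℕ → ℕ → ℕ
      c i j = 𝟙 (not (QR (i * i + j * j)))
      count half : ℕ → ℕ → ℕ
      count i j = 𝟙 (a i j) + 𝟙 (b i j) + c i j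
      half i j = ⌈ count i j /2⌉
      A B Nr W : ℕ
      A = ∑pairs m (λ i j → 𝟙 (a i j))
      B = ∑pairs m (λ i j → 𝟙 (b i j))
      Nr = nonresidue-pairs
      W = ∑pairs m half
      count-split : ∑pairs m count ≡ A + B + Nr
      count-split = trans (∑pairs-distrib m (λ i j → 𝟙 (a i j) + 𝟙 (b i j)) c)
                          (cong (_+ Nr) (∑pairs-distrib m (λ i j → 𝟙 (a i j)) (λ i j → 𝟙 (b i j))))
      A≡B : A ≡ B
      A≡B = sym (∑pairs-reindex m σ-inverseOn (λ x y → 𝟙 (lt⊕QR x y))
                  (λ x y 1≤x x≤m 1≤y y≤m → cong 𝟙 (lt⊕QR-sym x y 1≤x x≤m 1≤y y≤m)))

  nonresidues-1+l² : ℕ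
  nonresidues-1+l² = ∑ m (λ l → 𝟙 (not (QR (1 + l * l))))

  -- j ↦ j / i permutes the residues R, and i² + j² = i² (1 + (j/i)²)
  row-count : ∀ i → 1 ≤ i → i ≤ m → ∑ m (λ j → 𝟙 (not (QR (i * i + j * j)))) ≡ nonresidues-1+l²
  row-count i 1≤i i≤m = trans (∑-cong m entry) (∑-reindex m (R-*-inverseOn {i′} i′i≋1) (λ l → 𝟙 (not (QR (1 + l * l)))))
    where
      i≉0 : i ≉0
      i≉0 = ≤m⇒≉0 1≤i i≤m
      i′ : ℕ
      i′ = proj₁ (inverse i≉0)
      ii′≋1 : i * i′ ≋ 1
      ii′≋1 = proj₂ (inverse i≉0)
      i′i≋1 : i′ * i ≋ 1
      i′i≋1 = trans (≡⇒≋ (*-comm i′ i)) ii′≋1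
      l : ℕ → ℕ
      l j = R (i′ * j) p
      factor : ∀ j → i * i * (1 + l j * l j) ≋ i * i + j * j
      factor j = begin
        (i * i * (1 + l j * l j)) % p               ≡⟨ ≋-*ˡ (i * i) (≋-+ˡ 1 (±≋⇒≋² (R-± (i′ * j)))) ⟩
        (i * i * (1 + i′ * j * (i′ * j))) % p       ≡⟨ cong (_% p) (expand i i′ j) ⟩
        (i * i + (i * i′) * (i * i′) * (j * j)) % p ≡⟨ ≋-+ˡ (i * i) (trans (≋-*ʳ (j * j) (≋-* ii′≋1 ii′≋1))
                                                                           (≡⇒≋ (*-identityˡ (j * j)))) ⟩
        (i * i + j * j) % p                         ∎
        where open ≡-Reasoning
              expand : ∀ i i′ j → i * i * (1 + i′ * j * (i′ * j)) ≡ i * i + (i * i′) * (i * i′) * (j * j)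
              expand = solve-∀
      entry : ∀ j → 1 ≤ j → j ≤ m → 𝟙 (not (QR (i * i + j * j))) ≡ 𝟙 (not (QR (1 + l j * l j)))
      entry j 1≤j j≤m = cong (𝟙 ∘ not) (trans (QR-cong (sym (factor j))) (QR-square-* i≉0 1+l²≉0))
        where
          l-range : 1 ≤ l j × l j ≤ m
          l-range = R-range (≉0-* (inverse-≉0 i ii′≋1) (≤m⇒≉0 1≤j j≤m))
          1+l²≉0 : 1 + l j * l j ≉0
          1+l²≉0 = sum-of-squares-≉0 {1} (≉0-< ≤-refl 1<p) (≤m⇒≉0 (proj₁ l-range) (proj₂ l-range))

  nonresidue-pairs-count : nonresidue-pairs + nonresidue-pairs + m * 𝟙 (not (QR 2)) ≡ m * nonresidues-1+l²
  nonresidue-pairs-count = begin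
    nonresidue-pairs + nonresidue-pairs + m * 𝟙 (not (QR 2)) ≡⟨ cong (nonresidue-pairs + nonresidue-pairs +_) diagonal ⟨
    nonresidue-pairs + nonresidue-pairs + ∑diagonal m c      ≡⟨ ∑square-symmetric m c c-sym ⟩
    ∑square m c                                              ≡⟨ ∑-cong m row-count ⟩
    ∑ m (λ _ → nonresidues-1+l²)                             ≡⟨ ∑-const m nonresidues-1+l² ⟩
    m * nonresidues-1+l²                                     ∎
    where
      open ≡-Reasoning
      c : ℕ → ℕ → ℕ
      c i j = 𝟙 (not (QR (i * i + j * j)))
      c-sym : SymmetricOn m c
      c-sym i j _ _ _ _ = cong (λ z → 𝟙 (not (QR z))) (+-comm (i * i) (j * j))
      diagonal : ∑diagonal m c ≡ m * 𝟙 (not (QR 2))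
      diagonal = trans (∑-cong m (λ i 1≤i i≤m → cong (𝟙 ∘ not) (trans (QR-cong (≡⇒≋ (double (i * i))))
                                                                      (QR-square-* (≤m⇒≉0 1≤i i≤m) 2≉0))))
                       (∑-const m (𝟙 (not (QR 2))))
        where double : ∀ x → x + x ≡ x * 2
              double = solve-∀

  χ-1ₚ : χ -1ₚ ≡ -1ℤ
  χ-1ₚ = trans (χ-≉0 -1ₚ≉0) (cong ±1 QR-1ₚ)

  χ-−1ₚ* : ∀ x → χ (-1ₚ * x) ≡ -1ℤ *ℤ χ x
  χ-−1ₚ* x = trans (χ-* -1ₚ x) (cong (_*ℤ χ x) χ-1ₚ)

  ∑χ≡0 : ∑ℤ -1ₚ χ ≡ 0ℤ
  ∑χ≡0 = begin
    ∑ℤ -1ₚ χ                        ≡⟨ ∑-±-pairs χ χ-cong ⟨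
    ∑ℤ m (λ r → χ r +ℤ χ (-1ₚ * r)) ≡⟨ ∑ℤ-cong m (λ r _ _ → trans (cong (χ r +ℤ_) (χ-−1ₚ* r)) (cancel (χ r))) ⟩
    ∑ℤ m (λ _ → 0ℤ)                 ≡⟨ ∑ℤ-ε m ⟩
    0ℤ                              ∎
    where open ≡-Reasoning
          cancel : ∀ x → x +ℤ -1ℤ *ℤ x ≡ 0ℤ
          cancel = ℤ-Solver.solve-∀

  ∑χ∘suc≡-1 : ∑ℤ -1ₚ (χ ∘ suc) ≡ -1ℤ
  ∑χ∘suc≡-1 = begin
    S                ≡⟨ shift S ⟩
    (1ℤ +ℤ S) +ℤ -1ℤ ≡⟨ cong (_+ℤ -1ℤ) (trans ∑χ∘suc ∑χ≡0) ⟩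
    -1ℤ              ∎
    where open ≡-Reasoning
          S : ℤ
          S = ∑ℤ -1ₚ (χ ∘ suc)
          shift : ∀ x → x ≡ (1ℤ +ℤ x) +ℤ -1ℤ
          shift = ℤ-Solver.solve-∀

  -- τ r² ≋ r or −r according to χ r, and χ (−r) = −χ r
  twice-χ[1+τ²] : ∀ r → 1 ≤ r → r ≤ m →
    χ (1 + τ r * τ r) +ℤ χ (1 + τ r * τ r)
      ≡ (χ (1 + r) +ℤ χ (1 + -1ₚ * r)) +ℤ (χ r *ℤ χ (1 + r) +ℤ χ (-1ₚ * r) *ℤ χ (1 + -1ₚ * r))
  twice-χ[1+τ²] r 1≤r r≤m = by-view (QR-view r≉0)
    where
      r≉0 : r ≉0
      r≉0 = ≤m⇒≉0 1≤r r≤m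
      τ²≋r*r^m : τ r * τ r ≋ r * r ^ m
      τ²≋r*r^m = trans (±≋⇒≋² (R-± (r ^ suc k))) (≡⇒≋ (trans (sym (^-distribˡ-+-* r (suc k) (suc k))) (cong (r ^_) (2+2k≡ k))))
        where 2+2k≡ : ∀ k → suc k + suc k ≡ suc (suc (2 * k))
              2+2k≡ = solve-∀
      a b : ℤ
      a = χ (1 + r)
      b = χ (1 + -1ₚ * r)
      by-view : QRView r → χ (1 + τ r * τ r) +ℤ χ (1 + τ r * τ r) ≡ (a +ℤ b) +ℤ (χ r *ℤ a +ℤ χ (-1ₚ * r) *ℤ b)
      by-view (residue QRr r^m≋1) = begin
        χ (1 + τ r * τ r) +ℤ χ (1 + τ r * τ r)
          ≡⟨ cong (λ z → z +ℤ z) (χ-cong (≋-+ˡ 1 (trans τ²≋r*r^m (trans (≋-*ˡ r r^m≋1) (≡⇒≋ (*-identityʳ r)))))) ⟩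
        a +ℤ a                                     ≡⟨ identity a b ⟩
        (a +ℤ b) +ℤ (1ℤ *ℤ a +ℤ (-1ℤ *ℤ 1ℤ) *ℤ b) ≡⟨ cong (λ z → (a +ℤ b) +ℤ (z *ℤ a +ℤ (-1ℤ *ℤ z) *ℤ b)) χr≡1 ⟨
        (a +ℤ b) +ℤ (χ r *ℤ a +ℤ (-1ℤ *ℤ χ r) *ℤ b) ≡⟨ cong (λ z → (a +ℤ b) +ℤ (χ r *ℤ a +ℤ z *ℤ b)) (χ-−1ₚ* r) ⟨
        (a +ℤ b) +ℤ (χ r *ℤ a +ℤ χ (-1ₚ * r) *ℤ b) ∎
        where open ≡-Reasoning
              χr≡1 : χ r ≡ 1ℤ
              χr≡1 = trans (χ-≉0 r≉0) (cong ±1 QRr)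
              identity : ∀ a b → a +ℤ a ≡ (a +ℤ b) +ℤ (1ℤ *ℤ a +ℤ (-1ℤ *ℤ 1ℤ) *ℤ b)
              identity = ℤ-Solver.solve-∀
      by-view (nonresidue QRr r^m≋-1) = begin
        χ (1 + τ r * τ r) +ℤ χ (1 + τ r * τ r)
          ≡⟨ cong (λ z → z +ℤ z) (χ-cong (≋-+ˡ 1 (trans τ²≋r*r^m (trans (≋-*ˡ r r^m≋-1) (≡⇒≋ (*-comm r -1ₚ)))))) ⟩
        b +ℤ b                                     ≡⟨ identity a b ⟩
        (a +ℤ b) +ℤ (-1ℤ *ℤ a +ℤ (-1ℤ *ℤ -1ℤ) *ℤ b) ≡⟨ cong (λ z → (a +ℤ b) +ℤ (z *ℤ a +ℤ (-1ℤ *ℤ z) *ℤ b)) χr≡-1 ⟨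
        (a +ℤ b) +ℤ (χ r *ℤ a +ℤ (-1ℤ *ℤ χ r) *ℤ b) ≡⟨ cong (λ z → (a +ℤ b) +ℤ (χ r *ℤ a +ℤ z *ℤ b)) (χ-−1ₚ* r) ⟨
        (a +ℤ b) +ℤ (χ r *ℤ a +ℤ χ (-1ₚ * r) *ℤ b) ∎
        where open ≡-Reasoning
              χr≡-1 : χ r ≡ -1ℤ
              χr≡-1 = trans (χ-≉0 r≉0) (cong ±1 QRr)
              identity : ∀ a b → b +ℤ b ≡ (a +ℤ b) +ℤ (-1ℤ *ℤ a +ℤ (-1ℤ *ℤ -1ℤ) *ℤ b)
              identity = ℤ-Solver.solve-∀

  ∑χ[1+l²]≡-1 : ∑ℤ m (λ l → χ (1 + l * l)) ≡ -1ℤ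
  ∑χ[1+l²]≡-1 = half-of-−2 X (begin
    X +ℤ X                          ≡⟨ cong (λ z → z +ℤ z) (∑ℤ-reindex m τ-inverseOn F) ⟨
    ∑ℤ m (F ∘ τ) +ℤ ∑ℤ m (F ∘ τ)    ≡⟨ ∑ℤ-distrib m (F ∘ τ) (F ∘ τ) ⟨
    ∑ℤ m (λ r → F (τ r) +ℤ F (τ r)) ≡⟨ ∑ℤ-cong m twice-χ[1+τ²] ⟩
    ∑ℤ m (λ r → (g₁ r +ℤ g₁ (-1ₚ * r)) +ℤ (g₂ r +ℤ g₂ (-1ₚ * r)))
                                                              ≡⟨ ∑ℤ-distrib m (λ r → g₁ r +ℤ g₁ (-1ₚ * r)) (λ r → g₂ r +ℤ g₂ (-1ₚ * r)) ⟩
    ∑ℤ m (λ r → g₁ r +ℤ g₁ (-1ₚ * r)) +ℤ ∑ℤ m (λ r → g₂ r +ℤ g₂ (-1ₚ * r))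
                                                              ≡⟨ cong₂ _+ℤ_ (∑-±-pairs g₁ g₁-cong) (∑-±-pairs g₂ g₂-cong) ⟩
    ∑ℤ -1ₚ g₁ +ℤ ∑ℤ -1ₚ g₂          ≡⟨ cong₂ _+ℤ_ ∑χ∘suc≡-1 (trans ∑χ*χ∘suc ∑χ∘suc≡-1) ⟩
    -1ℤ +ℤ -1ℤ                      ∎)
    where
      open ≡-Reasoning
      F g₁ g₂ : ℕ → ℤ
      F l = χ (1 + l * l)
      g₁ w = χ (1 + w)
      g₂ w = χ w *ℤ χ (1 + w)
      g₁-cong : ∀ {a b} → a ≋ b → g₁ a ≡ g₁ b
      g₁-cong = χ-cong ∘ ≋-+ˡ 1
      g₂-cong : ∀ {a b} → a ≋ b → g₂ a ≡ g₂ b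
      g₂-cong a≋b = cong₂ _*ℤ_ (χ-cong a≋b) (g₁-cong a≋b)
      X : ℤ
      X = ∑ℤ m F
      τ-inverseOn : InverseOn m τ σ
      τ-inverseOn = InverseOn.sym-inverse σ-inverseOn
      half-of-−2 : ∀ x → x +ℤ x ≡ -1ℤ +ℤ -1ℤ → x ≡ -1ℤ
      half-of-−2 (ℤ.+ n)          ()
      half-of-−2 ℤ.-[1+ zero ]    _ = refl
      half-of-−2 ℤ.-[1+ suc n ]   ()

  -- χ (1 + l²) = 1 − 2·[1 + l² is a nonresidue], summed over l ≤ m
  nonresidues-1+l²≡1+k : nonresidues-1+l² ≡ suc k
  nonresidues-1+l²≡1+k = *-cancelˡ-≡ K (suc k) 2 (trans (double K) (trans (ℤₚ.+-injective (begin
    ℤ.+ (K + K)                         ≡⟨ cancel-−1 (ℤ.+ (K + K)) ⟩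
    1ℤ +ℤ (-1ℤ +ℤ ℤ.+ (K + K))          ≡⟨ cong (λ z → 1ℤ +ℤ (z +ℤ ℤ.+ (K + K))) ∑χ[1+l²]≡-1 ⟨
    1ℤ +ℤ (∑ℤ m χ[1+l²] +ℤ ℤ.+ (K + K)) ≡⟨ cong (λ z → 1ℤ +ℤ (∑ℤ m χ[1+l²] +ℤ ℤ.+ z)) (∑-distrib m b b) ⟨
    1ℤ +ℤ (∑ℤ m χ[1+l²] +ℤ ℤ.+ ∑ m (λ l → b l + b l))
                                                   ≡⟨ cong (λ z → 1ℤ +ℤ (∑ℤ m χ[1+l²] +ℤ z)) (∑ℤ-cast m (λ l → b l + b l)) ⟨
    1ℤ +ℤ (∑ℤ m χ[1+l²] +ℤ ∑ℤ m (λ l → ℤ.+ (b l + b l)))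
                                                   ≡⟨ cong (1ℤ +ℤ_) (∑ℤ-distrib m χ[1+l²] (λ l → ℤ.+ (b l + b l))) ⟨
    1ℤ +ℤ ∑ℤ m (λ l → χ[1+l²] l +ℤ ℤ.+ (b l + b l))
                                                   ≡⟨ cong (1ℤ +ℤ_) (∑ℤ-cong m entry) ⟩
    1ℤ +ℤ ∑ℤ m (λ _ → ℤ.+ 1)
      ≡⟨ cong (1ℤ +ℤ_) (trans (∑ℤ-cast m (λ _ → 1)) (cong ℤ.+_ (trans (∑-const m 1) (*-identityʳ m)))) ⟩
    ℤ.+ (suc m)                         ∎)) (1+m≡ k)))
    where
      open ≡-Reasoning
      K : ℕ
      K = nonresidues-1+l²
      b : ℕ → ℕ
      b l = 𝟙 (not (QR (1 + l * l)))
      χ[1+l²] : ℕ → ℤ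
      χ[1+l²] l = χ (1 + l * l)
      double : ∀ x → 2 * x ≡ x + x
      double x = cong (x +_) (+-identityʳ x)
      1+m≡ : ∀ k → suc (suc (2 * k)) ≡ 2 * suc k
      1+m≡ = solve-∀
      cancel-−1 : ∀ x → x ≡ 1ℤ +ℤ (-1ℤ +ℤ x)
      cancel-−1 = ℤ-Solver.solve-∀
      ±1+2𝟙not : ∀ u → ±1 u +ℤ ℤ.+ (𝟙 (not u) + 𝟙 (not u)) ≡ ℤ.+ 1
      ±1+2𝟙not true  = refl
      ±1+2𝟙not false = refl
      entry : ∀ l → 1 ≤ l → l ≤ m → χ[1+l²] l +ℤ ℤ.+ (b l + b l) ≡ ℤ.+ 1
      entry l 1≤l l≤m = trans (cong (_+ℤ ℤ.+ (b l + b l)) (χ-≉0 1+l²≉0)) (±1+2𝟙not (QR (1 + l * l)))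
        where 1+l²≉0 : 1 + l * l ≉0
              1+l²≉0 = sum-of-squares-≉0 {1} (≉0-< ≤-refl 1<p) (≤m⇒≉0 1≤l l≤m)

  [p+1]/8-even : ∀ {j} → k ≡ j + j → (p + 1) / 8 ≡ j
  [p+1]/8-even {j} k≡j+j = begin
    (p + 1) / 8     ≡⟨ cong (λ n → (n + 1) / 8) (trans p≡ (cong (λ n → 3 + 4 * n) k≡j+j)) ⟩
    (3 + 4 * (j + j) + 1) / 8 ≡⟨ cong (_/ 8) (p+1≡ j) ⟩
    (4 + j * 8) / 8 ≡⟨ +-distrib-/-∣ʳ 4 {j * 8} {8} (divides-refl j) ⟩
    0 + j * 8 / 8   ≡⟨ m*n/n≡m j 8 ⟩
    j               ∎
    where open ≡-Reasoning
          p+1≡ : ∀ j → 3 + 4 * (j + j) + 1 ≡ 4 + j * 8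
          p+1≡ = solve-∀

  [p+1]/8-odd : ∀ {j} → k ≡ suc (j + j) → (p + 1) / 8 ≡ suc j
  [p+1]/8-odd {j} k≡1+j+j = begin
    (p + 1) / 8                   ≡⟨ cong (λ n → (n + 1) / 8) (trans p≡ (cong (λ n → 3 + 4 * n) k≡1+j+j)) ⟩
    (3 + 4 * suc (j + j) + 1) / 8 ≡⟨ cong (_/ 8) (p+1≡ j) ⟩
    (suc j * 8) / 8               ≡⟨ m*n/n≡m (suc j) 8 ⟩
    suc j                         ∎
    where open ≡-Reasoning
          p+1≡ : ∀ j → 3 + 4 * suc (j + j) + 1 ≡ suc j * 8
          p+1≡ = solve-∀

  nonresidue-pairs≡m*[p+1]/8 : nonresidue-pairs ≡ m * ((p + 1) / 8)
  nonresidue-pairs≡m*[p+1]/8 = by-parity (even-or-odd k)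
    where
      Nr : ℕ
      Nr = nonresidue-pairs
      count : Nr + Nr + m * 𝟙 (not (QR 2)) ≡ m * suc k
      count = trans nonresidue-pairs-count (cong (m *_) nonresidues-1+l²≡1+k)
      by-parity : ∃ (λ j → k ≡ j + j) ⊎ ∃ (λ j → k ≡ suc (j + j)) → Nr ≡ m * ((p + 1) / 8)
      by-parity (inj₁ (j , k≡j+j)) = trans Nr≡m*j (cong (m *_) (sym ([p+1]/8-even k≡j+j)))
        where
          Nr≡m*j : Nr ≡ m * j
          Nr≡m*j = m+m≡n+n⇒m≡n (+-cancelʳ-≡ m _ _ (begin
            Nr + Nr + m                  ≡⟨ cong (Nr + Nr +_) (*-identityʳ m) ⟨
            Nr + Nr + m * 1              ≡⟨ cong (λ b → Nr + Nr + m * 𝟙 (not b)) (QR-2-even {j} k≡j+j) ⟨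
            Nr + Nr + m * 𝟙 (not (QR 2)) ≡⟨ trans count (cong (λ n → m * suc n) k≡j+j) ⟩
            m * suc (j + j)              ≡⟨ expand m j ⟩
            m * j + m * j + m            ∎))
            where open ≡-Reasoning
                  expand : ∀ m j → m * suc (j + j) ≡ m * j + m * j + m
                  expand = solve-∀
      by-parity (inj₂ (j , k≡1+j+j)) = trans Nr≡m*[1+j] (cong (m *_) (sym ([p+1]/8-odd k≡1+j+j)))
        where
          Nr≡m*[1+j] : Nr ≡ m * suc j
          Nr≡m*[1+j] = m+m≡n+n⇒m≡n (begin
            Nr + Nr                      ≡⟨ +-identityʳ (Nr + Nr) ⟨
            Nr + Nr + 0                  ≡⟨ cong (Nr + Nr +_) (*-zeroʳ m) ⟨
            Nr + Nr + m * 0              ≡⟨ cong (λ b → Nr + Nr + m * 𝟙 (not b)) (QR-2-odd {j} k≡1+j+j) ⟨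
            Nr + Nr + m * 𝟙 (not (QR 2)) ≡⟨ trans count (cong (λ n → m * suc n) k≡1+j+j) ⟩
            m * suc (suc (j + j))        ≡⟨ expand m j ⟩
            m * suc j + m * suc j        ∎)
            where open ≡-Reasoning
                  expand : ∀ m j → m * suc (suc (j + j)) ≡ m * suc j + m * suc j
                  expand = solve-∀

  N≡inversions : N p ≡ inversions
  N≡inversions = trans (length-filter-pairs (λ ij → R (proj₂ ij * proj₂ ij) p <? R (proj₁ ij * proj₁ ij) p) ((p ∸ 1) / 2))
                       (cong (λ n → ∑pairs n (λ i j → 𝟙 (lt (σ j) (σ i)))) [p∸1]/2≡m)

  N-parity : N p % 2 ≡ ((p + 1) / 8) % 2
  N-parity = begin
    N p % 2                 ≡⟨ cong (_% 2) N≡inversions ⟩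
    inversions % 2          ≡⟨ inversions-parity ⟩
    nonresidue-pairs % 2    ≡⟨ cong (_% 2) nonresidue-pairs≡m*[p+1]/8 ⟩
    (m * ((p + 1) / 8)) % 2 ≡⟨ odd*-%2 k ((p + 1) / 8) ⟩
    ((p + 1) / 8) % 2       ∎
    where open ≡-Reasoning

theorem1p5 : (p : ℕ) → .{{_ : NonZero p}} → Prime p → p % 4 ≡ 3 →
    N p % 2 ≡ ((p + 1) / 8) % 2
theorem1p5 p p-prime p%4≡3 = ThreeModFour.N-parity (p / 4) p≡3+4[p/4] p-prime
  where
    p≡3+4[p/4] : p ≡ 3 + 4 * (p / 4)
    p≡3+4[p/4] = trans (m≡m%n+[m/n]*n p 4) (cong₂ _+_ p%4≡3 (*-comm (p / 4) 4))
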